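{- Let $A=(a_{ij})$ be an $n\times n$ Ferrers matrix with $a_{nn}=0$, let $k\ge 1$ be the number of $0$'s in the last column of $A$, and let $A^\circ$ be obtained from $A$ by deleting its last row and last column. Then $$\mathrm{per}(B(A);\alpha)=(\alpha+k-1)\,x_n\,\mathrm{per}(B(A^\circ);\alpha)+x_ny_n\,\partial\,\mathrm{per}(B(A^\circ);\alpha),\qquad \partial=\sum_{i=1}^{n-k}\frac{\partial}{\partial x_i}+\sum_{j=1}^{n-1}\frac{\partial}{\partial y_j}.$$
   Context: A Ferrers matrix is a $\{0,1\}$-matrix whose entries are weakly decreasing down each column and weakly increasing across each row. For an $m\times m$ Ferrers matrix $A$, $B(A)=(a_{ij}y_j+(1-a_{ij})x_i)$ with indeterminates $x_1,\dots,x_m,y_1,\dots,y_m$. For an indeterminate $\alpha$ and $m\times m$ matrix $H$, $\mathrm{per}(H;\alpha)=\sum_{\sigma\in S_m}\alpha^{\mathrm{cyc}(\sigma)}\prod_i h_{i,\sigma(i)}$, where $\mathrm{cyc}(\sigma)$ is the number of cycles of $\sigma$ (and the empty matrix has $\alpha$-permanent $1$). -}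

module Defs where

open import Level using (0ℓ)
open import Data.Bool as B using (Bool; true; false; if_then_else_; _∧_; _∨_; not)
open import Data.Nat as ℕ using (ℕ; zero; suc; _∸_)
open import Data.Integer as ℤ using (ℤ; +_; -[1+_])
open import Data.Fin as F using (Fin; toℕ; inject₁; fromℕ)
open import Data.List as L using (List; []; _∷_; allFin; map; concatMap; foldr)
open import Data.Vec as V using (Vec; []; _∷_; lookup)
open import Relation.Nullary.Decidable using (⌊_⌋)
open import Algebra.Bundles using (CommutativeRing)

-- Two expressions denote the same polynomial (in ℤ[V], the free
-- commutative ring on V) iff they evaluate equally in every commutative
-- ring under every assignment of the indeterminates.

infixl 6 _⊕_
infixl 7 _⊗_

data Expr (V : Set) : Set where
  var : V → Expr V
  con : ℤ → Expr V
  _⊕_ : Expr V → Expr V → Expr V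
  _⊗_ : Expr V → Expr V → Expr V

module _ (R : CommutativeRing 0ℓ 0ℓ) where
  open CommutativeRing R

  natR : ℕ → Carrier
  natR zero = 0#
  natR (suc n) = 1# + natR n

  intR : ℤ → Carrier
  intR (+ n) = natR n
  intR -[1+ n ] = - natR (suc n)

  eval : {V : Set} → (V → Carrier) → Expr V → Carrier
  eval ρ (var v) = ρ v
  eval ρ (con c) = intR c
  eval ρ (e ⊕ f) = eval ρ e + eval ρ f
  eval ρ (e ⊗ f) = eval ρ e * eval ρ f

infix 4 _≈P_
_≈P_ : {V : Set} → Expr V → Expr V → Set₁
_≈P_ {V} e f = (R : CommutativeRing 0ℓ 0ℓ) (ρ : V → CommutativeRing.Carrier R) →
  CommutativeRing._≈_ R (eval R ρ e) (eval R ρ f)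

rename : {V W : Set} → (V → W) → Expr V → Expr W
rename g (var v) = var (g v)
rename g (con c) = con c
rename g (e ⊕ f) = rename g e ⊕ rename g f
rename g (e ⊗ f) = rename g e ⊗ rename g f

∂[_] : {V : Set} → (V → V → Bool) → V → Expr V → Expr V
∂[ eq ] v (var w) = if eq v w then con (+ 1) else con (+ 0)
∂[ eq ] v (con c) = con (+ 0)
∂[ eq ] v (e ⊕ f) = ∂[ eq ] v e ⊕ ∂[ eq ] v f
∂[ eq ] v (e ⊗ f) = ∂[ eq ] v e ⊗ f ⊕ e ⊗ ∂[ eq ] v f

sumE : {V : Set} → List (Expr V) → Expr V
sumE = foldr _⊕_ (con (+ 0))

prodE : {V : Set} {m : ℕ} → (Fin m → Expr V) → Expr V
prodE {m = zero} f = con (+ 1)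
prodE {m = suc m} f = f F.zero ⊗ prodE (λ i → f (F.suc i))

powE : {V : Set} → Expr V → ℕ → Expr V
powE e zero = con (+ 1)
powE e (suc n) = e ⊗ powE e n

-- Indeterminates α, x₁..x_n, y₁..y_n (0-based indices Fin n)

data Var (n : ℕ) : Set where
  α : Var n
  x : Fin n → Var n
  y : Fin n → Var n

eqFin : {n : ℕ} → Fin n → Fin n → Bool
eqFin i j = ⌊ i F.≟ j ⌋

eqVar : {n : ℕ} → Var n → Var n → Bool
eqVar α α = true
eqVar (x i) (x j) = eqFin i j
eqVar (y i) (y j) = eqFin i j
eqVar _ _ = false

liftVar : {n : ℕ} → Var n → Var (suc n)
liftVar α = α
liftVar (x i) = x (inject₁ i)
liftVar (y j) = y (inject₁ j)

-- Permutations of Fin m: all maps Fin m → Fin m (as vectors) that are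
-- injective.

allVecs : (m k : ℕ) → List (Vec (Fin m) k)
allVecs m zero = [] ∷ []
allVecs m (suc k) = concatMap (λ i → map (i ∷_) (allVecs m k)) (allFin m)

allB : {A : Set} → (A → Bool) → List A → Bool
allB p = foldr (λ a b → p a ∧ b) true

isPerm : {m : ℕ} → Vec (Fin m) m → Bool
isPerm {m} v = allB (λ i → allB (λ j → eqFin i j ∨ not (eqFin (lookup v i) (lookup v j))) (allFin m)) (allFin m)

filterB : {A : Set} → (A → Bool) → List A → List A
filterB p [] = []
filterB p (a ∷ as) = if p a then a ∷ filterB p as else filterB p as

perms : (m : ℕ) → List (Fin m → Fin m)
perms m = map lookup (filterB isPerm (allVecs m m))

iter : {m : ℕ} → (Fin m → Fin m) → ℕ → Fin m → Fin m
iter σ zero i = i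
iter σ (suc k) i = σ (iter σ k i)

-- i is the least element of its cycle (orbit under σ, which has at most
-- m elements σ⁰ i, …, σ^{m-1} i)
isCycleMin : {m : ℕ} → (Fin m → Fin m) → Fin m → Bool
isCycleMin {m} σ i = allB (λ k → ⌊ toℕ i ℕ.≤? toℕ (iter σ k i) ⌋) (L.upTo m)

countB : {A : Set} → (A → Bool) → List A → ℕ
countB p as = L.length (filterB p as)

-- number of cycles of σ = number of orbits = number of orbit minima
cyc : {m : ℕ} → (Fin m → Fin m) → ℕ
cyc {m} σ = countB (isCycleMin σ) (allFin m)

per : {m : ℕ} → (Fin m → Fin m → Expr (Var m)) → Expr (Var m)
per {m} H = sumE (map (λ σ → powE (var α) (cyc σ) ⊗ prodE (λ i → H i (σ i))) (perms m))

-- Ferrers matrices ({0,1} entries as Bool, true = 1)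

Matrix01 : ℕ → Set
Matrix01 m = Fin m → Fin m → Bool

IsFerrers : {m : ℕ} → Matrix01 m → Set
IsFerrers {m} A =
  (∀ (i i' j : Fin m) → i F.≤ i' → A i' j B.≤ A i j) ×′
  (∀ (i j j' : Fin m) → j F.≤ j' → A i j B.≤ A i j')
  where
  open import Data.Product using () renaming (_×_ to _×′_)

-- B(A) = (a_ij y_j + (1 - a_ij) x_i)
BM : {m : ℕ} → Matrix01 m → Fin m → Fin m → Expr (Var m)
BM A i j = if A i j then var (y j) else var (x i)

circ : {m : ℕ} → Matrix01 (suc m) → Matrix01 m
circ A i j = A (inject₁ i) (inject₁ j)

zerosLastCol : {m : ℕ} → Matrix01 (suc m) → ℕ
zerosLastCol {m} A = countB (λ i → not (A i (fromℕ m))) (allFin (suc m))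

-- ∂ = Σ_{i=1}^{n-k} ∂/∂x_i + Σ_{j=1}^{n-1} ∂/∂y_j  (n = suc m, 0-based)
∂op : (m k : ℕ) → Expr (Var (suc m)) → Expr (Var (suc m))
∂op m k e =
  sumE (map (λ i → ∂[ eqVar ] (x i) e)
            (filterB (λ i → ⌊ toℕ i ℕ.<? (suc m ∸ k) ⌋) (allFin (suc m))))
  ⊕ sumE (map (λ j → ∂[ eqVar ] (y j) e)
            (filterB (λ j → ⌊ toℕ j ℕ.<? m ⌋) (allFin (suc m))))

module Submission where

open import Level using (0ℓ)
open import Algebra.Bundles using (CommutativeRing; Semiring)
import Algebra.Definitions.RawSemiring as RawSemiringDefs
import Algebra.Properties.Monoid.Sum as MonoidSum
import Algebra.Properties.Semiring.Sum as SemiringSum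
import Algebra.Solver.Ring.NaturalCoefficients.Default as NatCoeffSolver
open import Data.Bool as Bool using (Bool; true; false; if_then_else_; _∧_; _∨_; not; b≤b)
open import Data.Empty using (⊥-elim)
open import Data.Fin as F using (Fin; zero; suc; toℕ; inject₁; fromℕ)
import Data.Fin.Properties as FP
open import Data.List as L using (List; []; _∷_; _++_)
import Data.List.Properties as LP
open import Data.List.Membership.Propositional using (_∈_; find)
open import Data.List.Membership.Propositional.Properties
  using (∈-map⁺; ∈-map⁻; ∈-concatMap⁺; ∈-concatMap⁻; ∈-allFin)
open import Data.List.Membership.Propositional.Properties.WithK using (unique∧set⇒bag)
open import Data.List.Relation.Binary.BagAndSetEquality using (∼bag⇒↭)
import Data.List.Relation.Binary.Permutation.Propositional as Perm
open import Data.List.Relation.Unary.All as All using (All; []; _∷_)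
open import Data.List.Relation.Unary.AllPairs using ([]; _∷_)
open import Data.List.Relation.Unary.Any as Any using (here; there)
open import Data.List.Relation.Unary.Unique.Propositional using (Unique)
import Data.List.Relation.Unary.Unique.Propositional.Properties as Unique
open import Data.Nat as ℕ using (ℕ; zero; suc; _∸_; _≤_; _<_; z≤n; s≤s)
open import Data.Nat.DivMod using (_%_; _/_; m≡m%n+[m/n]*n; m%n<n)
import Data.Nat.Properties as ℕP
open import Data.Product using (∃; _×_; _,_; proj₁; proj₂; map₁)
open import Data.Sum using (_⊎_; inj₁; inj₂)
open import Data.Vec as V using (Vec; []; _∷_)
import Data.Vec.Properties as VP
open import Function using (_∘_)
open import Function.Bundles using (mk⇔)
open import Function.Definitions using (Injective)
open import Relation.Nullary using (Dec; yes; no; ¬_)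
open import Relation.Nullary.Decidable using (⌊_⌋)
open import Relation.Binary.PropositionalEquality
  using (_≡_; _≗_; refl; sym; trans; cong; cong₂; subst; subst₂; module ≡-Reasoning)
open import Defs

-- Here A has size m + 1 and its last index is n = fromℕ m; the term of τ ∈ S_m
-- in per(B(A°)) is T(τ) = α^cyc τ ∏_l b_{l,τ l}.  Every σ ∈ S_{m+1} arises in
-- exactly one way from some τ ∈ S_m: either n is a new fixed point (σ = ext τ,
-- one more cycle) or n is inserted into the cycle of some i right after i
-- (σ = ins τ i, as many cycles); conversely τ = rem σ removes n.  As A is
-- Ferrers with a_nn = 0, its last row is zero, so B(A) has x_n at (n, σ n).
-- Hence the term of ext τ is α x_n T(τ), and the term of ins τ i is x_n T(τ)
-- if a_in = 0 (then row i is zero, so b_{i,τ i} = x_i), and otherwise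
-- x_n y_n T(τ) with the factor b_{i,τ i} removed.  There are k − 1 rows i ≠ n
-- with a_in = 0, and the rows with a_in = 1 are exactly the factors hit by the
-- derivations in ∂, so the last sum is x_n y_n ∂T(τ).

does⇒ : ∀ {P : Set} (d : Dec P) → ⌊ d ⌋ ≡ true → P
does⇒ (yes p) _ = p
does⇒ (no _) ()

⇒does : ∀ {P : Set} (d : Dec P) → P → ⌊ d ⌋ ≡ true
⇒does (yes _) _ = refl
⇒does (no ¬p) p = ⊥-elim (¬p p)

bool-ext : ∀ {b c : Bool} → (b ≡ true → c ≡ true) → (c ≡ true → b ≡ true) → b ≡ c
bool-ext {false} {false} _ _ = refl
bool-ext {false} {true} _ g = g refl
bool-ext {true} {false} f _ = sym (f refl)
bool-ext {true} {true} _ _ = refl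

∧-elim : ∀ {b c} → b ∧ c ≡ true → b ≡ true × c ≡ true
∧-elim {true} {true} _ = refl , refl

∧-intro : ∀ {b c} → b ≡ true → c ≡ true → b ∧ c ≡ true
∧-intro refl refl = refl

eqFin-≢ : {n : ℕ} {i j : Fin n} → ¬ i ≡ j → eqFin i j ≡ false
eqFin-≢ {i = i} {j} i≢j with i F.≟ j
... | yes e = ⊥-elim (i≢j e)
... | no _ = refl

eqFin-refl : {n : ℕ} (i : Fin n) → eqFin i i ≡ true
eqFin-refl i = ⇒does (i F.≟ i) refl

eqFin-suc : {n : ℕ} (a b : Fin n) → eqFin (suc a) (suc b) ≡ eqFin a b
eqFin-suc a b = bool-ext
  (λ e → ⇒does (a F.≟ b) (FP.suc-injective (does⇒ (suc a F.≟ suc b) e)))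
  (λ e → ⇒does (suc a F.≟ suc b) (cong suc (does⇒ (a F.≟ b) e)))

data LastView {m : ℕ} : Fin (suc m) → Set where
  last : LastView (fromℕ m)
  below : (l : Fin m) → LastView (inject₁ l)

lastView : ∀ {m} (j : Fin (suc m)) → LastView j
lastView {zero} zero = last
lastView {suc m} zero = below zero
lastView {suc m} (suc j) with lastView j
... | last = last
... | below l = below (suc l)

lastOrBelow : ∀ {m} (j : Fin (suc m)) → j ≡ fromℕ m ⊎ ∃ λ u → j ≡ inject₁ u
lastOrBelow j with lastView j
... | last = inj₁ refl
... | below u = inj₂ (u , refl)

caseLast : {m : ℕ} {A : Set} → A → (Fin m → A) → Fin (suc m) → A
caseLast {zero} a f zero = a
caseLast {suc m} a f zero = f zero
caseLast {suc m} a f (suc j) = caseLast a (λ l → f (suc l)) j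

caseLast-last : ∀ {m} {A : Set} (a : A) (f : Fin m → A) → caseLast a f (fromℕ m) ≡ a
caseLast-last {zero} a f = refl
caseLast-last {suc m} a f = caseLast-last {m} a (λ l → f (suc l))

caseLast-below : ∀ {m} {A : Set} (a : A) (f : Fin m → A) (l : Fin m) → caseLast a f (inject₁ l) ≡ f l
caseLast-below {suc m} a f zero = refl
caseLast-below {suc m} a f (suc l) = caseLast-below a (λ l → f (suc l)) l

last≢below : ∀ {m} {l : Fin m} → ¬ fromℕ m ≡ inject₁ l
last≢below = FP.fromℕ≢inject₁

Inj : {m : ℕ} → (Fin m → Fin m) → Set
Inj σ = Injective _≡_ _≡_ σ

ext : {m : ℕ} → (Fin m → Fin m) → Fin (suc m) → Fin (suc m)
ext {m} τ = caseLast (fromℕ m) (λ l → inject₁ (τ l))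

choose : {m : ℕ} → (Fin m → Fin m) → Fin m → Bool → Fin (suc m)
choose {m} τ l b = if b then fromℕ m else inject₁ (τ l)

-- τ with n inserted into the cycle of i, right after i:  i ↦ n ↦ τ i.
ins : {m : ℕ} → (Fin m → Fin m) → Fin m → Fin (suc m) → Fin (suc m)
ins τ i = caseLast (inject₁ (τ i)) (λ l → choose τ l (eqFin l i))

-- σ with n cut out of its cycle: l ↦ σ l, except that the preimage of n goes to σ n.
rem : {m : ℕ} → (Fin (suc m) → Fin (suc m)) → Fin m → Fin m
rem {m} σ l = caseLast (caseLast l (λ u → u) (σ (fromℕ m))) (λ u → u) (σ (inject₁ l))

ext-last : ∀ {m} (τ : Fin m → Fin m) → ext τ (fromℕ m) ≡ fromℕ m
ext-last {m} τ = caseLast-last {m} _ _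

ext-below : ∀ {m} (τ : Fin m → Fin m) l → ext τ (inject₁ l) ≡ inject₁ (τ l)
ext-below τ l = caseLast-below _ _ l

ins-last : ∀ {m} (τ : Fin m → Fin m) i → ins τ i (fromℕ m) ≡ inject₁ (τ i)
ins-last {m} τ i = caseLast-last {m} _ _

data InsBelow {m : ℕ} (τ : Fin m → Fin m) (i l : Fin m) : Set where
  hit : l ≡ i → ins τ i (inject₁ l) ≡ fromℕ m → InsBelow τ i l
  miss : ¬ l ≡ i → ins τ i (inject₁ l) ≡ inject₁ (τ l) → InsBelow τ i l

insBelow : ∀ {m} (τ : Fin m → Fin m) i l → InsBelow τ i l
insBelow τ i l with l F.≟ i
... | yes refl = hit refl (trans (caseLast-below _ _ i) (cong (choose τ i) (eqFin-refl i)))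
... | no l≢i = miss l≢i (trans (caseLast-below _ _ l) (cong (choose τ l) (eqFin-≢ l≢i)))

rem-below : ∀ {m} (σ : Fin (suc m) → Fin (suc m)) l u → σ (inject₁ l) ≡ inject₁ u → rem σ l ≡ u
rem-below σ l u e rewrite e = caseLast-below _ _ u

rem-last : ∀ {m} (σ : Fin (suc m) → Fin (suc m)) l u →
  σ (inject₁ l) ≡ fromℕ m → σ (fromℕ m) ≡ inject₁ u → rem σ l ≡ u
rem-last {m} σ l u e e' rewrite e | caseLast-last (caseLast l (λ u → u) (σ (fromℕ m))) (λ u → u) | e' =
  caseLast-below _ _ u

rem-cong : ∀ {m} {σ σ' : Fin (suc m) → Fin (suc m)} → σ ≗ σ' → rem σ ≗ rem σ'
rem-cong {m} H l rewrite H (inject₁ l) | H (fromℕ m) = refl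

rem-ext : ∀ {m} (τ : Fin m → Fin m) → rem (ext τ) ≗ τ
rem-ext τ l = rem-below (ext τ) l (τ l) (ext-below τ l)

rem-ins : ∀ {m} (τ : Fin m → Fin m) i → rem (ins τ i) ≗ τ
rem-ins τ i l with insBelow τ i l
... | hit refl h = rem-last (ins τ i) l (τ l) h (ins-last τ i)
... | miss _ h = rem-below (ins τ i) l (τ l) h

ext-Inj : ∀ {m} (τ : Fin m → Fin m) → Inj τ → Inj (ext τ)
ext-Inj τ inj {a} {b} e with lastView a | lastView b
... | last | last = refl
... | last | below l = ⊥-elim (last≢below (trans (sym (ext-last τ)) (trans e (ext-below τ l))))
... | below l | last = ⊥-elim (last≢below (trans (sym (ext-last τ)) (trans (sym e) (ext-below τ l))))
... | below l | below l' =
  cong inject₁ (inj (FP.inject₁-injective (trans (sym (ext-below τ l)) (trans e (ext-below τ l')))))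

ins-below≢ : ∀ {m} (τ : Fin m → Fin m) i → Inj τ → ∀ l → ¬ ins τ i (inject₁ l) ≡ inject₁ (τ i)
ins-below≢ τ i inj l e with insBelow τ i l
... | hit _ h = last≢below (trans (sym h) e)
... | miss l≢i h = l≢i (inj (FP.inject₁-injective (trans (sym h) e)))

ins-Inj : ∀ {m} (τ : Fin m → Fin m) i → Inj τ → Inj (ins τ i)
ins-Inj τ i inj {a} {b} e with lastView a | lastView b
... | last | last = refl
... | last | below l = ⊥-elim (ins-below≢ τ i inj l (trans (sym e) (ins-last τ i)))
... | below l | last = ⊥-elim (ins-below≢ τ i inj l (trans e (ins-last τ i)))
... | below l | below l' with insBelow τ i l | insBelow τ i l'
...   | hit p _ | hit p' _ = cong inject₁ (trans p (sym p'))
...   | hit _ h | miss _ h' = ⊥-elim (last≢below (trans (sym h) (trans e h')))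
...   | miss _ h | hit _ h' = ⊥-elim (last≢below (trans (sym h') (trans (sym e) h)))
...   | miss _ h | miss _ h' = cong inject₁ (inj (FP.inject₁-injective (trans (sym h) (trans e h'))))

ext-Inj⁻ : ∀ {m} (τ : Fin m → Fin m) → Inj (ext τ) → Inj τ
ext-Inj⁻ τ inj {a} {b} e =
  FP.inject₁-injective (inj (trans (ext-below τ a) (trans (cong inject₁ e) (sym (ext-below τ b)))))

ins-Inj⁻ : ∀ {m} (τ : Fin m → Fin m) i → Inj (ins τ i) → Inj τ
ins-Inj⁻ τ i inj {a} {b} e with insBelow τ i a | insBelow τ i b
... | hit p _ | hit p' _ = trans p (sym p')
... | hit refl _ | miss _ h = ⊥-elim (last≢below (inj (trans (ins-last τ a) (trans (cong inject₁ e) (sym h)))))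
... | miss _ h | hit refl _ = ⊥-elim (last≢below (inj (trans (ins-last τ b) (trans (cong inject₁ (sym e)) (sym h)))))
... | miss _ h | miss _ h' = FP.inject₁-injective (inj (trans h (trans (cong inject₁ e) (sym h'))))

belowLast : ∀ {m} {σ : Fin (suc m) → Fin (suc m)} → Inj σ → ∀ {a b} →
  σ a ≡ fromℕ m → ¬ b ≡ a → ∃ λ u → σ b ≡ inject₁ u
belowLast {σ = σ} inj {a} {b} σa b≢a with lastOrBelow (σ b)
... | inj₁ σb = ⊥-elim (b≢a (inj (trans σb (sym σa))))
... | inj₂ r = r

fixesLast⇒ext : ∀ {m} (σ : Fin (suc m) → Fin (suc m)) → Inj σ → σ (fromℕ m) ≡ fromℕ m →
  (τ : Fin m → Fin m) → τ ≗ rem σ → σ ≗ ext τ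
fixesLast⇒ext σ inj σn τ τ≗ j with lastView j
... | last = trans σn (sym (ext-last τ))
... | below l with belowLast inj σn (λ e → last≢below (sym e))
...   | u , σl = trans σl (sym (trans (ext-below τ l) (cong inject₁ (trans (τ≗ l) (rem-below σ l u σl)))))

hitsLast⇒ins : ∀ {m} (σ : Fin (suc m) → Fin (suc m)) → Inj σ → ∀ i → σ (inject₁ i) ≡ fromℕ m →
  (τ : Fin m → Fin m) → τ ≗ rem σ → σ ≗ ins τ i
hitsLast⇒ins σ inj i σi τ τ≗ j with lastView j
... | last with belowLast inj σi last≢below
...   | u , σn = trans σn (sym (trans (ins-last τ i) (cong inject₁ (trans (τ≗ i) (rem-last σ i u σi σn)))))
hitsLast⇒ins σ inj i σi τ τ≗ j | below l with insBelow τ i l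
... | hit refl h = trans σi (sym h)
... | miss l≢i h with belowLast inj σi (λ e → l≢i (FP.inject₁-injective e))
...   | u , σl = trans σl (sym (trans h (cong inject₁ (trans (τ≗ l) (rem-below σ l u σl)))))

Inj⇒onto : ∀ {N} (σ : Fin N → Fin N) → Inj σ → ∀ t → ∃ λ j → σ j ≡ t
Inj⇒onto {zero} σ inj ()
Inj⇒onto {suc N} σ inj t with FP.any? (λ j → σ j F.≟ t)
... | yes r = r
... | no ¬r = ⊥-elim (ℕP.<-irrefl refl (FP.injective⇒≤ {f = g} g-inj))
  where
  g : Fin (suc N) → Fin N
  g j = F.punchOut {i = t} {j = σ j} (λ e → ¬r (j , sym e))
  g-inj : Injective _≡_ _≡_ g
  g-inj {a} {b} e = inj (FP.punchOut-injective {i = t} (λ e → ¬r (a , sym e)) (λ e → ¬r (b , sym e)) e)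

decompose : ∀ {m} (σ : Fin (suc m) → Fin (suc m)) → Inj σ → (τ : Fin m → Fin m) → τ ≗ rem σ →
  σ ≗ ext τ ⊎ ∃ λ i → σ ≗ ins τ i
decompose {m} σ inj τ τ≗ with lastOrBelow (σ (fromℕ m))
... | inj₁ σn = inj₁ (fixesLast⇒ext σ inj σn τ τ≗)
... | inj₂ (u , σn) with Inj⇒onto σ inj (fromℕ m)
...   | j , σj with lastView j
...     | last = ⊥-elim (last≢below (trans (sym σj) σn))
...     | below i = inj₂ (i , hitsLast⇒ins σ inj i σj τ τ≗)

-- Orbits.  isCycleMin σ l tests that l is below its first N iterates; for an
-- injective σ this says that l is the least point of its orbit (OrbitMin),
-- because every orbit closes up within N steps.

iter-add : ∀ {N} (σ : Fin N → Fin N) a b z → iter σ (a ℕ.+ b) z ≡ iter σ a (iter σ b z)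
iter-add σ zero b z = refl
iter-add σ (suc a) b z = cong σ (iter-add σ a b z)

iter-Inj : ∀ {N} (σ : Fin N → Fin N) → Inj σ → ∀ a {u v} → iter σ a u ≡ iter σ a v → u ≡ v
iter-Inj σ inj zero e = e
iter-Inj σ inj (suc a) e = iter-Inj σ inj a (inj e)

iter-cong : ∀ {N} {σ σ' : Fin N → Fin N} → σ ≗ σ' → ∀ k z → iter σ k z ≡ iter σ' k z
iter-cong H zero z = refl
iter-cong {σ = σ} H (suc k) z = trans (cong σ (iter-cong H k z)) (H _)

OrbitMin : ∀ {N} → (Fin N → Fin N) → Fin N → Set
OrbitMin σ l = ∀ k → toℕ l ≤ toℕ (iter σ k l)

-- Every point comes back after some 0 < d ≤ N steps (pigeonhole on its first N+1 iterates).
period : ∀ {N} (σ : Fin N → Fin N) → Inj σ → (l : Fin N) →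
  ∃ λ d → 0 < d × d ≤ N × iter σ d l ≡ l
period {N} σ inj l with FP.pigeonhole (ℕP.n<1+n N) (λ j → iter σ (toℕ j) l)
... | i , j , i<j , e =
  d , ℕP.m<n⇒0<n∸m i<j , ℕP.≤-trans (ℕP.m∸n≤m (toℕ j) (toℕ i)) (ℕP.≤-pred (FP.toℕ<n j)) ,
  iter-Inj σ inj (toℕ i) (begin
    iter σ (toℕ i) (iter σ d l) ≡⟨ iter-add σ (toℕ i) d l ⟨
    iter σ (toℕ i ℕ.+ d) l      ≡⟨ cong (λ z → iter σ z l) (ℕP.m+[n∸m]≡n (ℕP.<⇒≤ i<j)) ⟩
    iter σ (toℕ j) l            ≡⟨ e ⟨
    iter σ (toℕ i) l            ∎)
  where
  open ≡-Reasoning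
  d = toℕ j ∸ toℕ i

iter-periodic : ∀ {N} (σ : Fin N → Fin N) {d l} → iter σ d l ≡ l → ∀ q → iter σ (q ℕ.* d) l ≡ l
iter-periodic σ σᵈl zero = refl
iter-periodic σ {d} {l} σᵈl (suc q) =
  trans (iter-add σ d (q ℕ.* d) l) (trans (cong (iter σ d) (iter-periodic σ σᵈl q)) σᵈl)

-- The orbit of l is covered by its first N iterates.
prefix⇒OrbitMin : ∀ {N} (σ : Fin N → Fin N) → Inj σ → (l : Fin N) →
  (∀ k → k < N → toℕ l ≤ toℕ (iter σ k l)) → OrbitMin σ l
prefix⇒OrbitMin {N} σ inj l H k with period σ inj l
... | d , 0<d , d≤N , σᵈl = subst (λ z → toℕ l ≤ toℕ z) (sym reduce) (H (k % d) (ℕP.<-≤-trans (m%n<n k d) d≤N))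
  where
  instance _ = ℕ.>-nonZero 0<d
  reduce : iter σ k l ≡ iter σ (k % d) l
  reduce = trans (cong (λ z → iter σ z l) (m≡m%n+[m/n]*n k d))
             (trans (iter-add σ (k % d) ((k / d) ℕ.* d) l) (cong (iter σ (k % d)) (iter-periodic σ σᵈl (k / d))))

allB-upTo⇒ : ∀ (p : ℕ → Bool) (f : ℕ → ℕ) n →
  allB p (L.applyUpTo f n) ≡ true → ∀ k → k < n → p (f k) ≡ true
allB-upTo⇒ p f (suc n) e zero _ = proj₁ (∧-elim e)
allB-upTo⇒ p f (suc n) e (suc k) (s≤s k<n) = allB-upTo⇒ p (λ z → f (suc z)) n (proj₂ (∧-elim {p (f zero)} e)) k k<n

allB-upTo⇐ : ∀ (p : ℕ → Bool) (f : ℕ → ℕ) n →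
  (∀ k → k < n → p (f k) ≡ true) → allB p (L.applyUpTo f n) ≡ true
allB-upTo⇐ p f zero H = refl
allB-upTo⇐ p f (suc n) H =
  ∧-intro (H zero (s≤s z≤n)) (allB-upTo⇐ p (λ z → f (suc z)) n (λ k k<n → H (suc k) (s≤s k<n)))

isCycleMin⇒ : ∀ {N} (σ : Fin N → Fin N) → Inj σ → ∀ l → isCycleMin σ l ≡ true → OrbitMin σ l
isCycleMin⇒ {N} σ inj l e = prefix⇒OrbitMin σ inj l (λ k k<N →
  does⇒ (toℕ l ℕ.≤? toℕ (iter σ k l))
    (allB-upTo⇒ (λ k → ⌊ toℕ l ℕ.≤? toℕ (iter σ k l) ⌋) (λ z → z) N e k k<N))

isCycleMin⇐ : ∀ {N} (σ : Fin N → Fin N) l → OrbitMin σ l → isCycleMin σ l ≡ true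
isCycleMin⇐ {N} σ l H = allB-upTo⇐ (λ k → ⌊ toℕ l ℕ.≤? toℕ (iter σ k l) ⌋) (λ z → z) N
  (λ k _ → ⇒does (toℕ l ℕ.≤? toℕ (iter σ k l)) (H k))

isCycleMin-transfer : ∀ {M N} (σ : Fin M → Fin M) (τ : Fin N → Fin N) → Inj σ → Inj τ → ∀ i l →
  (OrbitMin σ i → OrbitMin τ l) → (OrbitMin τ l → OrbitMin σ i) → isCycleMin σ i ≡ isCycleMin τ l
isCycleMin-transfer σ τ σ-inj τ-inj i l f g = bool-ext
  (λ e → isCycleMin⇐ τ l (f (isCycleMin⇒ σ σ-inj i e)))
  (λ e → isCycleMin⇐ σ i (g (isCycleMin⇒ τ τ-inj l e)))

ind : Bool → ℕ
ind true = 1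
ind false = 0

countB-∷ : ∀ {A : Set} (p : A → Bool) a as → countB p (a ∷ as) ≡ ind (p a) ℕ.+ countB p as
countB-∷ p a as with p a
... | true = refl
... | false = refl

countB-tab-cong : ∀ {A B : Set} {N} (p : A → Bool) (q : B → Bool) (g : Fin N → A) (h : Fin N → B) →
  (∀ i → p (g i) ≡ q (h i)) → countB p (L.tabulate g) ≡ countB q (L.tabulate h)
countB-tab-cong {N = zero} p q g h H = refl
countB-tab-cong {N = suc N} p q g h H = begin
    countB p (L.tabulate g)
  ≡⟨ countB-∷ p (g zero) (L.tabulate (g ∘ suc)) ⟩
    ind (p (g zero)) ℕ.+ countB p (L.tabulate (g ∘ suc))
  ≡⟨ cong₂ ℕ._+_ (cong ind (H zero)) (countB-tab-cong p q _ _ (H ∘ suc)) ⟩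
    ind (q (h zero)) ℕ.+ countB q (L.tabulate (h ∘ suc))
  ≡⟨ countB-∷ q (h zero) (L.tabulate (h ∘ suc)) ⟨
    countB q (L.tabulate h) ∎
  where open ≡-Reasoning

countB-tab-last : ∀ {A : Set} {N} (p : A → Bool) (g : Fin (suc N) → A) →
  countB p (L.tabulate g) ≡ countB p (L.tabulate (g ∘ inject₁)) ℕ.+ ind (p (g (fromℕ N)))
countB-tab-last {N = zero} p g = trans (countB-∷ p (g zero) []) (ℕP.+-comm (ind (p (g zero))) 0)
countB-tab-last {N = suc N} p g = begin
    countB p (L.tabulate g)
  ≡⟨ countB-∷ p (g zero) (L.tabulate (g ∘ suc)) ⟩
    first ℕ.+ countB p (L.tabulate (g ∘ suc))
  ≡⟨ cong (first ℕ.+_) (countB-tab-last p (g ∘ suc)) ⟩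
    first ℕ.+ (countB p (L.tabulate (g ∘ suc ∘ inject₁)) ℕ.+ lastInd)
  ≡⟨ ℕP.+-assoc first _ lastInd ⟨
    (first ℕ.+ countB p (L.tabulate (g ∘ suc ∘ inject₁))) ℕ.+ lastInd
  ≡⟨ cong (ℕ._+ lastInd) (countB-∷ p (g zero) (L.tabulate (g ∘ suc ∘ inject₁))) ⟨
    countB p (L.tabulate (g ∘ inject₁)) ℕ.+ lastInd ∎
  where
  open ≡-Reasoning
  first = ind (p (g zero))
  lastInd = ind (p (g (fromℕ (suc N))))

cyc-last : ∀ {m} (σ : Fin (suc m) → Fin (suc m)) →
  cyc σ ≡ countB (isCycleMin σ ∘ inject₁) (L.allFin m) ℕ.+ ind (isCycleMin σ (fromℕ m))
cyc-last {m} σ = trans (countB-tab-last (isCycleMin σ) (λ z → z))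
  (cong (ℕ._+ ind (isCycleMin σ (fromℕ m)))
    (countB-tab-cong (isCycleMin σ) (isCycleMin σ ∘ inject₁) inject₁ (λ z → z) (λ _ → refl)))

allB-cong : ∀ {A : Set} (p q : A → Bool) (xs : List A) → (∀ a → p a ≡ q a) → allB p xs ≡ allB q xs
allB-cong p q [] H = refl
allB-cong p q (a ∷ xs) H = cong₂ _∧_ (H a) (allB-cong p q xs H)

cyc-cong : ∀ {m} {σ σ' : Fin m → Fin m} → σ ≗ σ' → cyc σ ≡ cyc σ'
cyc-cong {m} {σ} {σ'} H = countB-tab-cong (isCycleMin σ) (isCycleMin σ') (λ z → z) (λ z → z)
  (λ i → allB-cong _ _ (L.upTo m) (λ k → cong (λ z → ⌊ toℕ i ℕ.≤? toℕ z ⌋) (iter-cong H k i)))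

iter-ext-below : ∀ {m} (τ : Fin m → Fin m) k l → iter (ext τ) k (inject₁ l) ≡ inject₁ (iter τ k l)
iter-ext-below τ zero l = refl
iter-ext-below τ (suc k) l = trans (cong (ext τ) (iter-ext-below τ k l)) (ext-below τ _)

iter-ext-last : ∀ {m} (τ : Fin m → Fin m) k → iter (ext τ) k (fromℕ m) ≡ fromℕ m
iter-ext-last τ zero = refl
iter-ext-last τ (suc k) = trans (cong (ext τ) (iter-ext-last τ k)) (ext-last τ)

toℕ-inject₁-≤ : ∀ {m} {l u : Fin m} {v : Fin (suc m)} → v ≡ inject₁ u →
  toℕ l ≤ toℕ u → toℕ (inject₁ l) ≤ toℕ v
toℕ-inject₁-≤ {l = l} {u} refl = subst₂ _≤_ (sym (FP.toℕ-inject₁ l)) (sym (FP.toℕ-inject₁ u))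

toℕ-inject₁-≤⁻ : ∀ {m} {l u : Fin m} {v : Fin (suc m)} → v ≡ inject₁ u →
  toℕ (inject₁ l) ≤ toℕ v → toℕ l ≤ toℕ u
toℕ-inject₁-≤⁻ {l = l} {u} refl = subst₂ _≤_ (FP.toℕ-inject₁ l) (FP.toℕ-inject₁ u)

cyc-ext : ∀ {m} (τ : Fin m → Fin m) → Inj τ → cyc (ext τ) ≡ suc (cyc τ)
cyc-ext {m} τ inj = trans (cyc-last (ext τ)) (trans (cong₂ ℕ._+_
  (countB-tab-cong _ _ (λ z → z) (λ z → z) (λ l →
    isCycleMin-transfer (ext τ) τ (ext-Inj τ inj) inj (inject₁ l) l
      (λ H k → toℕ-inject₁-≤⁻ (iter-ext-below τ k l) (H k))
      (λ H k → toℕ-inject₁-≤ (iter-ext-below τ k l) (H k))))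
  (cong ind (isCycleMin⇐ (ext τ) (fromℕ m) (λ k → ℕP.≤-reflexive (cong toℕ (sym (iter-ext-last τ k)))))))
  (ℕP.+-comm (cyc τ) 1))

module InsOrbit {m : ℕ} (τ : Fin m → Fin m) (i l : Fin m) where
  private σ = ins τ i

  reached : ∀ k' → ∃ λ k → iter σ k (inject₁ l) ≡ inject₁ (iter τ k' l)
  reached zero = 0 , refl
  reached (suc k') with reached k'
  ... | k , e with insBelow τ i (iter τ k' l)
  ...   | hit p h = suc (suc k) , trans (cong σ (trans (cong σ e) h)) (trans (ins-last τ i) (cong (inject₁ ∘ τ) (sym p)))
  ...   | miss _ h = suc k , trans (cong σ e) h

  visited : ∀ k → (iter σ k (inject₁ l) ≡ fromℕ m × ∃ λ k' → iter τ k' l ≡ i)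
                ⊎ (∃ λ k' → iter σ k (inject₁ l) ≡ inject₁ (iter τ k' l))
  visited zero = inj₂ (0 , refl)
  visited (suc k) with visited k
  ... | inj₁ (e , k' , e') = inj₂ (suc k' , trans (cong σ e) (trans (ins-last τ i) (cong (inject₁ ∘ τ) (sym e'))))
  ... | inj₂ (k' , e) with insBelow τ i (iter τ k' l)
  ...   | hit p h = inj₁ (trans (cong σ e) h , k' , p)
  ...   | miss _ h = inj₂ (suc k' , trans (cong σ e) h)

  orbitMin⇒ : OrbitMin σ (inject₁ l) → OrbitMin τ l
  orbitMin⇒ H k' with reached k'
  ... | k , e = toℕ-inject₁-≤⁻ e (H k)

  orbitMin⇐ : OrbitMin τ l → OrbitMin σ (inject₁ l)
  orbitMin⇐ H k with visited k
  ... | inj₁ (e , _) = subst (λ z → toℕ (inject₁ l) ≤ toℕ z) (sym e)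
                         (ℕP.<⇒≤ (subst (toℕ (inject₁ l) <_) (sym (FP.toℕ-fromℕ m)) (FP.inject₁ℕ< l)))
  ... | inj₂ (k' , e) = toℕ-inject₁-≤ e (H k')

cyc-ins : ∀ {m} (τ : Fin m → Fin m) i → Inj τ → cyc (ins τ i) ≡ cyc τ
cyc-ins {m} τ i inj = trans (cyc-last (ins τ i)) (trans (cong₂ ℕ._+_
  (countB-tab-cong _ _ (λ z → z) (λ z → z) (λ l →
    isCycleMin-transfer (ins τ i) τ (ins-Inj τ i inj) inj (inject₁ l) l
      (InsOrbit.orbitMin⇒ τ i l) (InsOrbit.orbitMin⇐ τ i l)))
  (cong ind lastNotMin)) (ℕP.+-identityʳ (cyc τ)))
  where
  -- n is not the least point of its cycle, since ins τ i n = inject₁ (τ i) < n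
  lastNotMin : isCycleMin (ins τ i) (fromℕ m) ≡ false
  lastNotMin with isCycleMin (ins τ i) (fromℕ m) in e
  ... | false = refl
  ... | true = ⊥-elim (ℕP.<⇒≱ step (isCycleMin⇒ (ins τ i) (ins-Inj τ i inj) (fromℕ m) e 1))
    where
    step : toℕ (iter (ins τ i) 1 (fromℕ m)) < toℕ (fromℕ m)
    step = subst₂ _<_ (sym (cong toℕ (ins-last τ i))) (sym (FP.toℕ-fromℕ m)) (FP.inject₁ℕ< (τ i))

-- The list perms (suc m) is a rearrangement of the list obtained by growing
-- each element of perms m in its m + 1 ways.  Permutations are handled as
-- vectors (lookup tables), whose equality is decidable: both lists are
-- duplicate-free and have the same members, hence are permutations of each other.

filterB-∈⁺ : ∀ {A : Set} (p : A → Bool) {a} (xs : List A) → a ∈ xs → p a ≡ true → a ∈ filterB p xs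
filterB-∈⁺ p (b ∷ xs) (here refl) e rewrite e = here refl
filterB-∈⁺ p (b ∷ xs) (there a∈) e with p b
... | true = there (filterB-∈⁺ p xs a∈ e)
... | false = filterB-∈⁺ p xs a∈ e

filterB-∈⁻ : ∀ {A : Set} (p : A → Bool) {a} (xs : List A) → a ∈ filterB p xs → a ∈ xs × p a ≡ true
filterB-∈⁻ p (b ∷ xs) a∈ with p b in e
filterB-∈⁻ p (b ∷ xs) (here refl) | true = here refl , e
filterB-∈⁻ p (b ∷ xs) (there a∈) | true = map₁ there (filterB-∈⁻ p xs a∈)
filterB-∈⁻ p (b ∷ xs) a∈ | false = map₁ there (filterB-∈⁻ p xs a∈)

filterB-All : ∀ {A : Set} {P : A → Set} (p : A → Bool) (xs : List A) → All P xs → All P (filterB p xs)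
filterB-All p [] [] = []
filterB-All p (b ∷ xs) (pb ∷ ps) with p b
... | true = pb ∷ filterB-All p xs ps
... | false = filterB-All p xs ps

filterB-Unique : ∀ {A : Set} (p : A → Bool) (xs : List A) → Unique xs → Unique (filterB p xs)
filterB-Unique p [] u = []
filterB-Unique p (b ∷ xs) (h ∷ u) with p b
... | true = filterB-All p xs h ∷ filterB-Unique p xs u
... | false = filterB-Unique p xs u

concatMap-Unique : ∀ {A B : Set} (f : A → List B) (xs : List A) → Unique xs → (∀ a → Unique (f a)) →
  (∀ a b {z} → z ∈ f a → z ∈ f b → a ≡ b) → Unique (L.concatMap f xs)
concatMap-Unique f [] u uf disj = []
concatMap-Unique f (a ∷ xs) (a∉ ∷ u) uf disj = Unique.++⁺ (uf a) (concatMap-Unique f xs u uf disj) apart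
  where
  apart : ∀ {v} → ¬ (v ∈ f a × v ∈ L.concatMap f xs)
  apart (p , q) with find (∈-concatMap⁻ f {xs = xs} q)
  ... | b , b∈xs , v∈fb = All.lookup a∉ b∈xs (disj a b p v∈fb)

allB-∈⇒ : ∀ {A : Set} (p : A → Bool) (xs : List A) → allB p xs ≡ true → ∀ {a} → a ∈ xs → p a ≡ true
allB-∈⇒ p (b ∷ xs) e (here refl) = proj₁ (∧-elim e)
allB-∈⇒ p (b ∷ xs) e (there a∈) = allB-∈⇒ p xs (proj₂ (∧-elim {p b} e)) a∈

allB-∈⇐ : ∀ {A : Set} (p : A → Bool) (xs : List A) → (∀ {a} → a ∈ xs → p a ≡ true) → allB p xs ≡ true
allB-∈⇐ p [] H = refl
allB-∈⇐ p (b ∷ xs) H = ∧-intro (H (here refl)) (allB-∈⇐ p xs (H ∘ there))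

allVecs-complete : ∀ m k (v : Vec (Fin m) k) → v ∈ allVecs m k
allVecs-complete m zero [] = here refl
allVecs-complete m (suc k) (i ∷ w) = ∈-concatMap⁺ (λ j → L.map (j ∷_) (allVecs m k)) {xs = L.allFin m}
  (Any.map (λ { refl → ∈-map⁺ (i ∷_) (allVecs-complete m k w) }) (∈-allFin i))

allVecs-Unique : ∀ m k → Unique (allVecs m k)
allVecs-Unique m zero = [] ∷ []
allVecs-Unique m (suc k) = concatMap-Unique (λ j → L.map (j ∷_) (allVecs m k)) (L.allFin m) (Unique.allFin⁺ m)
  (λ _ → Unique.map⁺ VP.∷-injectiveʳ (allVecs-Unique m k))
  (λ a b p q → sameHead (∈-map⁻ (a ∷_) p) (∈-map⁻ (b ∷_) q))
  where
  sameHead : ∀ {a b} {z : Vec (Fin m) (suc k)} →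
    (∃ λ w → w ∈ allVecs m k × z ≡ a ∷ w) → (∃ λ w → w ∈ allVecs m k × z ≡ b ∷ w) → a ≡ b
  sameHead (_ , _ , e) (_ , _ , e') = VP.∷-injectiveˡ (trans (sym e) e')

isPerm⇒ : ∀ {m} (v : Vec (Fin m) m) → isPerm v ≡ true → Inj (V.lookup v)
isPerm⇒ {m} v e {i} {j} vi≡vj =
  pairOk (allB-∈⇒ _ (L.allFin m) (allB-∈⇒ _ (L.allFin m) e (∈-allFin i)) (∈-allFin j))
  where
  pairOk : (eqFin i j ∨ not (eqFin (V.lookup v i) (V.lookup v j))) ≡ true → i ≡ j
  pairOk h with i F.≟ j
  ... | yes i≡j = i≡j
  ... | no _ with () ← subst (λ b → not b ≡ true) (⇒does (V.lookup v i F.≟ V.lookup v j) vi≡vj) h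

isPerm⇐ : ∀ {m} (v : Vec (Fin m) m) → Inj (V.lookup v) → isPerm v ≡ true
isPerm⇐ {m} v inj = allB-∈⇐ _ (L.allFin m) (λ {i} _ → allB-∈⇐ _ (L.allFin m) (λ {j} _ → pairOk i j))
  where
  pairOk : ∀ i j → (eqFin i j ∨ not (eqFin (V.lookup v i) (V.lookup v j))) ≡ true
  pairOk i j with i F.≟ j
  ... | yes _ = refl
  ... | no i≢j rewrite eqFin-≢ (λ e → i≢j (inj e)) = refl

Inj-resp : ∀ {N} {f g : Fin N → Fin N} → f ≗ g → Inj f → Inj g
Inj-resp f≗g inj {a} {b} e = inj (trans (f≗g a) (trans e (sym (f≗g b))))

permVecs : (m : ℕ) → List (Vec (Fin m) m)
permVecs m = filterB isPerm (allVecs m m)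

permVecs-∈⁺ : ∀ {m} (v : Vec (Fin m) m) → Inj (V.lookup v) → v ∈ permVecs m
permVecs-∈⁺ {m} v inj = filterB-∈⁺ isPerm (allVecs m m) (allVecs-complete m m v) (isPerm⇐ v inj)

permVecs-∈⁻ : ∀ {m} {v : Vec (Fin m) m} → v ∈ permVecs m → Inj (V.lookup v)
permVecs-∈⁻ {m} {v} v∈ = isPerm⇒ v (proj₂ (filterB-∈⁻ isPerm (allVecs m m) v∈))

permVecs-Unique : ∀ m → Unique (permVecs m)
permVecs-Unique m = filterB-Unique isPerm (allVecs m m) (allVecs-Unique m m)

≗⇒≡tabulate : ∀ {n k} (v : Vec (Fin k) n) (f : Fin n → Fin k) → V.lookup v ≗ f → v ≡ V.tabulate f
≗⇒≡tabulate v f H = trans (sym (VP.tabulate∘lookup v)) (VP.tabulate-cong H)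

extV : ∀ {m} → Vec (Fin m) m → Vec (Fin (suc m)) (suc m)
extV w = V.tabulate (ext (V.lookup w))

insV : ∀ {m} → Vec (Fin m) m → Fin m → Vec (Fin (suc m)) (suc m)
insV w i = V.tabulate (ins (V.lookup w) i)

remV : ∀ {m} → Vec (Fin (suc m)) (suc m) → Vec (Fin m) m
remV v = V.tabulate (rem (V.lookup v))

block : ∀ {m} → Vec (Fin m) m → List (Vec (Fin (suc m)) (suc m))
block {m} w = extV w ∷ L.map (insV w) (L.allFin m)

grown : (m : ℕ) → List (Vec (Fin (suc m)) (suc m))
grown m = L.concatMap block (permVecs m)

block-rem : ∀ {m} (w : Vec (Fin m) m) {z} → z ∈ block w → remV z ≡ w
block-rem w (here refl) = sym (≗⇒≡tabulate w _ λ l →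
  sym (trans (rem-cong (VP.lookup∘tabulate (ext (V.lookup w))) l) (rem-ext (V.lookup w) l)))
block-rem {m} w (there z∈) with ∈-map⁻ (insV w) {xs = L.allFin m} z∈
... | i , _ , refl = sym (≗⇒≡tabulate w _ λ l →
  sym (trans (rem-cong (VP.lookup∘tabulate (ins (V.lookup w) i)) l) (rem-ins (V.lookup w) i l)))

-- The members of a block are distinct: they differ in the images of n and of inject₁ i.
block-Unique : ∀ {m} (w : Vec (Fin m) m) → Unique (block w)
block-Unique {m} w = All.tabulate extV∉ ∷ Unique.map⁺ insV-injective (Unique.allFin⁺ m)
  where
  τ = V.lookup w
  atLast : ∀ {z} → z ∈ L.map (insV w) (L.allFin m) → ∃ λ u → V.lookup z (fromℕ m) ≡ inject₁ u
  atLast z∈ with ∈-map⁻ (insV w) {xs = L.allFin m} z∈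
  ... | i , _ , refl = τ i , trans (VP.lookup∘tabulate (ins τ i) (fromℕ m)) (ins-last τ i)
  extV∉ : ∀ {z} → z ∈ L.map (insV w) (L.allFin m) → ¬ extV w ≡ z
  extV∉ z∈ refl with atLast z∈
  ... | u , e = last≢below (trans (sym (trans (VP.lookup∘tabulate (ext τ) (fromℕ m)) (ext-last τ))) e)
  insV-injective : ∀ {i j} → insV w i ≡ insV w j → i ≡ j
  insV-injective {i} {j} e with insBelow τ j i
  ... | hit i≡j _ = i≡j
  ... | miss _ h = ⊥-elim (last≢below (begin
    fromℕ m                              ≡⟨ hitAt i ⟨
    V.lookup (insV w i) (inject₁ i)      ≡⟨ cong (λ v → V.lookup v (inject₁ i)) e ⟩
    V.lookup (insV w j) (inject₁ i)      ≡⟨ VP.lookup∘tabulate (ins τ j) (inject₁ i) ⟩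
    ins τ j (inject₁ i)                  ≡⟨ h ⟩
    inject₁ (τ i)                        ∎))
    where
    open ≡-Reasoning
    hitAt : ∀ i → V.lookup (insV w i) (inject₁ i) ≡ fromℕ m
    hitAt i with insBelow τ i i
    ... | hit _ h = trans (VP.lookup∘tabulate (ins τ i) (inject₁ i)) h
    ... | miss i≢i _ = ⊥-elim (i≢i refl)

grown-Unique : ∀ m → Unique (grown m)
grown-Unique m = concatMap-Unique block (permVecs m) (permVecs-Unique m) block-Unique
  (λ a b p q → trans (sym (block-rem a p)) (block-rem b q))

tabulate-Inj : ∀ {N} (f : Fin N → Fin N) → Inj f → Inj (V.lookup (V.tabulate f))
tabulate-Inj f inj = Inj-resp (λ j → sym (VP.lookup∘tabulate f j)) inj

grown-∈⁻ : ∀ m {z} → z ∈ grown m → z ∈ permVecs (suc m)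
grown-∈⁻ m {z} z∈ with find (∈-concatMap⁻ block {xs = permVecs m} z∈)
... | w , w∈ , here refl = permVecs-∈⁺ _ (tabulate-Inj _ (ext-Inj _ (permVecs-∈⁻ w∈)))
... | w , w∈ , there z∈ins with ∈-map⁻ (insV w) {xs = L.allFin m} z∈ins
...   | i , _ , refl = permVecs-∈⁺ _ (tabulate-Inj _ (ins-Inj _ i (permVecs-∈⁻ w∈)))

inGrown : ∀ m {w z} → Inj (V.lookup w) → z ∈ block w → z ∈ grown m
inGrown m {w} w-inj z∈b = ∈-concatMap⁺ block {xs = permVecs m} (Any.map (λ { refl → z∈b }) (permVecs-∈⁺ w w-inj))

grown-∈⁺ : ∀ m {z} → z ∈ permVecs (suc m) → z ∈ grown m
grown-∈⁺ m {z} z∈ with decompose (V.lookup z) (permVecs-∈⁻ z∈) (V.lookup (remV z)) (VP.lookup∘tabulate _)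
... | inj₁ σ≗ = inGrown m {remV z} (ext-Inj⁻ _ (Inj-resp σ≗ (permVecs-∈⁻ z∈))) (here (≗⇒≡tabulate z _ σ≗))
... | inj₂ (i , σ≗) = inGrown m {remV z} (ins-Inj⁻ _ i (Inj-resp σ≗ (permVecs-∈⁻ z∈)))
  (there (subst (_∈ L.map (insV (remV z)) (L.allFin m)) (sym (≗⇒≡tabulate z _ σ≗))
    (∈-map⁺ (insV (remV z)) (∈-allFin i))))

perms-step : ∀ m → permVecs (suc m) Perm.↭ grown m
perms-step m =
  ∼bag⇒↭ (unique∧set⇒bag (permVecs-Unique (suc m)) (grown-Unique m) (mk⇔ (grown-∈⁺ m) (grown-∈⁻ m)))

countB-all : ∀ {A : Set} {N} (p : A → Bool) (g : Fin N → A) → (∀ i → p (g i) ≡ true) → countB p (L.tabulate g) ≡ N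
countB-all {N = zero} p g H = refl
countB-all {N = suc N} p g H =
  trans (countB-∷ p (g zero) (L.tabulate (g ∘ suc)))
    (cong₂ ℕ._+_ (cong ind (H zero)) (countB-all p (g ∘ suc) (H ∘ suc)))

countB-≤ : ∀ {A : Set} {N} (p : A → Bool) (g : Fin N → A) → countB p (L.tabulate g) ≤ N
countB-≤ {N = zero} p g = z≤n
countB-≤ {N = suc N} p g rewrite countB-∷ p (g zero) (L.tabulate (g ∘ suc)) with p (g zero)
... | true = s≤s (countB-≤ p (g ∘ suc))
... | false = ℕP.m≤n⇒m≤1+n (countB-≤ p (g ∘ suc))

<?-suc : ∀ a b → ⌊ suc a ℕ.<? suc b ⌋ ≡ ⌊ a ℕ.<? b ⌋
<?-suc a b = bool-ext (λ e → ⇒does (a ℕ.<? b) (ℕP.≤-pred (does⇒ (suc a ℕ.<? suc b) e)))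
  (λ e → ⇒does (suc a ℕ.<? suc b) (s≤s (does⇒ (a ℕ.<? b) e)))

Decreasing : ∀ {N} → (Fin N → Bool) → Set
Decreasing f = ∀ i i' → toℕ i ≤ toℕ i' → f i' ≡ true → f i ≡ true

zeros : ∀ {N} → (Fin N → Bool) → ℕ
zeros {N} f = countB (not ∘ f) (L.allFin N)

zeros-suc : ∀ {N} (f : Fin (suc N) → Bool) → zeros f ≡ ind (not (f zero)) ℕ.+ zeros (f ∘ suc)
zeros-suc f = trans (countB-∷ (not ∘ f) zero (L.tabulate suc))
  (cong (ind (not (f zero)) ℕ.+_) (countB-tab-cong (not ∘ f) (not ∘ f ∘ suc) suc (λ i → i) (λ _ → refl)))

rows : ∀ {N} (f : Fin (suc N) → Bool) → f zero ≡ true → suc N ∸ zeros f ≡ suc (N ∸ zeros (f ∘ suc))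
rows {N} f f₀ = trans (cong (suc N ∸_) (trans (zeros-suc f) (cong (λ b → ind (not b) ℕ.+ zeros (f ∘ suc)) f₀)))
  (ℕP.+-∸-assoc 1 (countB-≤ (not ∘ f ∘ suc) (λ i → i)))

column-top0 : ∀ {N} (f : Fin (suc N) → Bool) → Decreasing f → f zero ≡ false →
  ∀ j → f j ≡ ⌊ toℕ j ℕ.<? (suc N ∸ zeros f) ⌋
column-top0 {N} f dec f₀ j = trans (allZero j) (sym (does-false (toℕ j)))
  where
  allZero : ∀ j → f j ≡ false
  allZero j with f j in fj
  ... | false = refl
  ... | true = trans (sym (dec zero j z≤n fj)) f₀
  noRows : suc N ∸ zeros f ≡ 0
  noRows = trans (cong (suc N ∸_) (trans (zeros-suc f) (cong (λ b → ind (not b) ℕ.+ zeros (f ∘ suc)) f₀)))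
             (trans (cong (N ∸_) (countB-all _ (λ i → i) (λ i → cong not (allZero (suc i))))) (ℕP.n∸n≡0 N))
  does-false : ∀ t → ⌊ t ℕ.<? (suc N ∸ zeros f) ⌋ ≡ false
  does-false t rewrite noRows = refl

column-top1 : ∀ {N} (f : Fin (suc N) → Bool) → f zero ≡ true →
  (∀ j → f (suc j) ≡ ⌊ toℕ j ℕ.<? (N ∸ zeros (f ∘ suc)) ⌋) →
  ∀ j → f j ≡ ⌊ toℕ j ℕ.<? (suc N ∸ zeros f) ⌋
column-top1 {N} f f₀ rest zero =
  trans f₀ (sym (⇒does (0 ℕ.<? (suc N ∸ zeros f)) (subst (0 <_) (sym (rows f f₀)) (s≤s z≤n))))
column-top1 {N} f f₀ rest (suc j) =
  trans (rest j) (sym (trans (cong (λ t → ⌊ suc (toℕ j) ℕ.<? t ⌋) (rows f f₀))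
    (<?-suc (toℕ j) (N ∸ zeros (f ∘ suc)))))

decreasing-column : ∀ N (f : Fin N → Bool) → Decreasing f → ∀ j → f j ≡ ⌊ toℕ j ℕ.<? (N ∸ zeros f) ⌋
decreasing-column (suc N) f dec = byTop (f zero) refl
  where
  byTop : ∀ b → f zero ≡ b → ∀ j → f j ≡ ⌊ toℕ j ℕ.<? (suc N ∸ zeros f) ⌋
  byTop false f₀ = column-top0 f dec f₀
  byTop true f₀ = column-top1 f f₀ (decreasing-column N (f ∘ suc) (λ i i' le → dec (suc i) (suc i') (s≤s le)))

≤-true : ∀ {b c} → b Bool.≤ c → b ≡ true → c ≡ true
≤-true b≤b e = e

≤-false : ∀ {b c} → b Bool.≤ c → c ≡ false → b ≡ false
≤-false b≤b e = e

rename-sumE-map : ∀ {V W A : Set} (g : V → W) (F : A → Expr V) (xs : List A) →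
  rename g (sumE (L.map F xs)) ≡ sumE (L.map (rename g ∘ F) xs)
rename-sumE-map g F [] = refl
rename-sumE-map g F (a ∷ xs) = cong (rename g (F a) ⊕_) (rename-sumE-map g F xs)

rename-prodE : ∀ {V W : Set} {m} (g : V → W) (f : Fin m → Expr V) → rename g (prodE f) ≡ prodE (rename g ∘ f)
rename-prodE {m = zero} g f = refl
rename-prodE {m = suc m} g f = cong (rename g (f zero) ⊗_) (rename-prodE g (f ∘ suc))

rename-powE : ∀ {V W : Set} (g : V → W) (v : V) c → rename g (powE (var v) c) ≡ powE (var (g v)) c
rename-powE g v zero = refl
rename-powE g v (suc c) = cong (var (g v) ⊗_) (rename-powE g v c)

prodE-cong : ∀ {V : Set} {m} {f g : Fin m → Expr V} → f ≗ g → prodE f ≡ prodE g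
prodE-cong {m = zero} H = refl
prodE-cong {m = suc m} H = cong₂ _⊗_ (H zero) (prodE-cong (H ∘ suc))

∂-sumE-map : ∀ {V A : Set} (eq : V → V → Bool) (v : V) (F : A → Expr V) (xs : List A) →
  ∂[ eq ] v (sumE (L.map F xs)) ≡ sumE (L.map (∂[ eq ] v ∘ F) xs)
∂-sumE-map eq v F [] = refl
∂-sumE-map eq v F (a ∷ xs) = cong (∂[ eq ] v (F a) ⊕_) (∂-sumE-map eq v F xs)

entry : ∀ {m} → Matrix01 m → Fin m → Fin m → Var m
entry A i j = if A i j then y j else x i

BM-entry : ∀ {m} (A : Matrix01 m) i j → BM A i j ≡ var (entry A i j)
BM-entry A i j with A i j
... | true = refl
... | false = refl

liftVar-entry : ∀ {m} (A : Matrix01 (suc m)) l j → liftVar (entry (circ A) l j) ≡ entry A (inject₁ l) (inject₁ j)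
liftVar-entry A l j with A (inject₁ l) (inject₁ j)
... | true = refl
... | false = refl

permSum : ∀ {m N} → ((Fin m → Fin m) → Fin m → Var N) → Expr (Var N)
permSum {m} W = sumE (L.map (λ τ → powE (var α) (cyc τ) ⊗ prodE (λ l → var (W τ l))) (perms m))

per-BM : ∀ {m} (A : Matrix01 m) → per (BM A) ≡ permSum (λ σ i → entry A i (σ i))
per-BM {m} A = cong sumE (LP.map-cong
  (λ σ → cong (powE (var α) (cyc σ) ⊗_) (prodE-cong (λ i → BM-entry A i (σ i)))) (perms m))

rename-per-BM : ∀ {m} (A : Matrix01 (suc m)) →
  rename liftVar (per (BM (circ A))) ≡ permSum (λ τ l → entry A (inject₁ l) (inject₁ (τ l)))
rename-per-BM {m} A = trans (cong (rename liftVar) (per-BM (circ A)))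
  (trans (rename-sumE-map liftVar _ (perms m)) (cong sumE (LP.map-cong (λ τ →
    cong₂ _⊗_ (rename-powE liftVar α (cyc τ))
      (trans (rename-prodE liftVar _) (prodE-cong (λ l → cong var (liftVar-entry A l (τ l)))))) (perms m))))

module RingSums (R : CommutativeRing 0ℓ 0ℓ) where
  open CommutativeRing R hiding (zero) renaming (refl to ≈-refl; reflexive to ≈-reflexive; sym to ≈-sym; trans to ≈-trans)
  open SemiringSum semiring public
    using (sum; ∑-distrib-+; *-distribˡ-sum; sum-replicate-zero) renaming (sum-cong-≋ to sum-cong)
  open MonoidSum *-monoid public using () renaming (sum to prod; sum-cong-≋ to prod-cong; sum-init-last to prod-init-last)
  open RawSemiringDefs (Semiring.rawSemiring semiring) public using (_^_)
  open NatCoeffSolver commutativeSemiring using (solve; _:+_; _:*_; _:=_)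
  open import Relation.Binary.Reasoning.Setoid setoid

  ΣL : {A : Set} → List A → (A → Carrier) → Carrier
  ΣL [] f = 0#
  ΣL (a ∷ xs) f = f a + ΣL xs f

  ΣL-cong∈ : {A : Set} (xs : List A) {f g : A → Carrier} → (∀ a → a ∈ xs → f a ≈ g a) → ΣL xs f ≈ ΣL xs g
  ΣL-cong∈ [] H = ≈-refl
  ΣL-cong∈ (a ∷ xs) H = +-cong (H a (here refl)) (ΣL-cong∈ xs (λ b b∈ → H b (there b∈)))

  ΣL-cong : {A : Set} (xs : List A) {f g : A → Carrier} → (∀ a → f a ≈ g a) → ΣL xs f ≈ ΣL xs g
  ΣL-cong xs H = ΣL-cong∈ xs (λ a _ → H a)

  ΣL-+ : {A : Set} (xs : List A) (f g : A → Carrier) → ΣL xs (λ a → f a + g a) ≈ ΣL xs f + ΣL xs g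
  ΣL-+ [] f g = ≈-sym (+-identityʳ 0#)
  ΣL-+ (a ∷ xs) f g = ≈-trans (+-cong ≈-refl (ΣL-+ xs f g))
    (solve 4 (λ p q r s → (p :+ q) :+ (r :+ s) := (p :+ r) :+ (q :+ s)) ≈-refl (f a) (g a) (ΣL xs f) (ΣL xs g))

  ΣL-*ˡ : {A : Set} (xs : List A) (c : Carrier) (f : A → Carrier) → ΣL xs (λ a → c * f a) ≈ c * ΣL xs f
  ΣL-*ˡ [] c f = ≈-sym (zeroʳ c)
  ΣL-*ˡ (a ∷ xs) c f = ≈-trans (+-cong ≈-refl (ΣL-*ˡ xs c f)) (≈-sym (distribˡ c (f a) (ΣL xs f)))

  ΣL-*ʳ : {A : Set} (xs : List A) (f : A → Carrier) (c : Carrier) → ΣL xs (λ a → f a * c) ≈ ΣL xs f * c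
  ΣL-*ʳ xs f c = ≈-trans (ΣL-cong xs (λ a → *-comm (f a) c)) (≈-trans (ΣL-*ˡ xs c f) (*-comm c _))

  ΣL-0 : {A : Set} (xs : List A) → ΣL xs (λ _ → 0#) ≈ 0#
  ΣL-0 [] = ≈-refl
  ΣL-0 (a ∷ xs) = ≈-trans (+-identityˡ _) (ΣL-0 xs)

  ΣL-map : {A B : Set} (h : A → B) (xs : List A) (f : B → Carrier) → ΣL (L.map h xs) f ≡ ΣL xs (f ∘ h)
  ΣL-map h [] f = refl
  ΣL-map h (a ∷ xs) f = cong (f (h a) +_) (ΣL-map h xs f)

  ΣL-++ : {A : Set} (xs ys : List A) (f : A → Carrier) → ΣL (xs ++ ys) f ≈ ΣL xs f + ΣL ys f
  ΣL-++ [] ys f = ≈-sym (+-identityˡ _)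
  ΣL-++ (a ∷ xs) ys f = ≈-trans (+-cong ≈-refl (ΣL-++ xs ys f)) (≈-sym (+-assoc _ _ _))

  ΣL-concatMap : {A B : Set} (g : A → List B) (xs : List A) (f : B → Carrier) →
    ΣL (L.concatMap g xs) f ≈ ΣL xs (λ a → ΣL (g a) f)
  ΣL-concatMap g [] f = ≈-refl
  ΣL-concatMap g (a ∷ xs) f = ≈-trans (ΣL-++ (g a) (L.concatMap g xs) f) (+-cong ≈-refl (ΣL-concatMap g xs f))

  ΣL-↭ : {A : Set} {xs ys : List A} (f : A → Carrier) → xs Perm.↭ ys → ΣL xs f ≈ ΣL ys f
  ΣL-↭ f Perm.refl = ≈-refl
  ΣL-↭ f (Perm.prep a p) = +-cong ≈-refl (ΣL-↭ f p)
  ΣL-↭ f (Perm.swap {ys = ys} a b p) = ≈-trans (+-cong ≈-refl (+-cong ≈-refl (ΣL-↭ f p)))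
    (solve 3 (λ p q r → p :+ (q :+ r) := q :+ (p :+ r)) ≈-refl (f a) (f b) (ΣL ys f))
  ΣL-↭ f (Perm.trans p q) = ≈-trans (ΣL-↭ f p) (ΣL-↭ f q)

  ΣL-filterB : {A : Set} (p : A → Bool) (xs : List A) (f : A → Carrier) →
    ΣL (filterB p xs) f ≈ ΣL xs (λ a → if p a then f a else 0#)
  ΣL-filterB p [] f = ≈-refl
  ΣL-filterB p (a ∷ xs) f with p a
  ... | true = +-cong ≈-refl (ΣL-filterB p xs f)
  ... | false = ≈-trans (ΣL-filterB p xs f) (≈-sym (+-identityˡ _))

  ΣL-swap : {A B : Set} (xs : List A) (ys : List B) (f : A → B → Carrier) →
    ΣL xs (λ a → ΣL ys (f a)) ≈ ΣL ys (λ b → ΣL xs (λ a → f a b))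
  ΣL-swap [] ys f = ≈-sym (ΣL-0 ys)
  ΣL-swap (a ∷ xs) ys f =
    ≈-trans (+-cong ≈-refl (ΣL-swap xs ys f)) (≈-sym (ΣL-+ ys (f a) (λ b → ΣL xs (λ a' → f a' b))))

  ΣL-tabulate : {m : ℕ} {A : Set} (g : Fin m → A) (f : A → Carrier) → ΣL (L.tabulate g) f ≡ sum (f ∘ g)
  ΣL-tabulate {zero} g f = refl
  ΣL-tabulate {suc m} g f = cong (f (g zero) +_) (ΣL-tabulate (g ∘ suc) f)

  ΣL-allFin : {m : ℕ} (f : Fin m → Carrier) → ΣL (L.allFin m) f ≡ sum f
  ΣL-allFin f = ΣL-tabulate (λ i → i) f

  prodExcept : {m : ℕ} → Fin m → (Fin m → Carrier) → Carrier
  prodExcept i f = prod (λ l → if eqFin l i then 1# else f l)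

  prod-pick : {m : ℕ} (i : Fin m) (u : Carrier) (f : Fin m → Carrier) →
    prod (λ l → if eqFin l i then u else f l) ≈ u * prodExcept i f
  prod-pick {suc m} zero u f = *-cong ≈-refl (≈-sym (*-identityˡ _))
  prod-pick {suc m} (suc i) u f = begin
      f zero * prod (λ l → if eqFin (suc l) (suc i) then u else f (suc l))
    ≈⟨ *-cong ≈-refl (prod-cong (shift u)) ⟩
      f zero * prod (λ l → if eqFin l i then u else f (suc l))
    ≈⟨ *-cong ≈-refl (prod-pick i u (f ∘ suc)) ⟩
      f zero * (u * prodExcept i (f ∘ suc))
    ≈⟨ solve 3 (λ p q r → p :* (q :* r) := q :* (p :* r)) ≈-refl (f zero) u (prodExcept i (f ∘ suc)) ⟩
      u * (f zero * prodExcept i (f ∘ suc))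
    ≈⟨ *-cong ≈-refl (*-cong ≈-refl (prod-cong (λ l → ≈-sym (shift 1# l)))) ⟩
      u * prodExcept (suc i) f ∎
    where
    shift : ∀ v l → (if eqFin (suc l) (suc i) then v else f (suc l)) ≈ (if eqFin l i then v else f (suc l))
    shift v l = ≈-reflexive (cong (λ b → if b then v else f (suc l)) (eqFin-suc l i))

  prod-split : {m : ℕ} (i : Fin m) (f : Fin m → Carrier) → prod f ≈ f i * prodExcept i f
  prod-split i f = ≈-trans (prod-cong atI) (prod-pick i (f i) f)
    where
    atI : ∀ l → f l ≈ (if eqFin l i then f i else f l)
    atI l with l F.≟ i
    ... | yes refl = ≈-refl
    ... | no _ = ≈-refl

  indR : Bool → Carrier
  indR true = 1#
  indR false = 0#

  natR-+ : ∀ a b → natR R (a ℕ.+ b) ≈ natR R a + natR R b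
  natR-+ zero b = ≈-sym (+-identityˡ _)
  natR-+ (suc a) b = ≈-trans (+-cong ≈-refl (natR-+ a b)) (≈-sym (+-assoc _ _ _))

  natR-ind : ∀ b → natR R (ind b) ≈ indR b
  natR-ind true = +-identityʳ 1#
  natR-ind false = ≈-refl

  sum-count : {m : ℕ} {A : Set} (g : Fin m → A) (c : A → Bool) (z : Carrier) →
    sum (λ i → if c (g i) then 0# else z) ≈ natR R (countB (not ∘ c) (L.tabulate g)) * z
  sum-count {zero} g c z = ≈-sym (zeroˡ z)
  sum-count {suc m} g c z = begin
      (if c (g zero) then 0# else z) + sum (λ i → if c (g (suc i)) then 0# else z)
    ≈⟨ +-cong (term (c (g zero))) (sum-count (g ∘ suc) c z) ⟩
      indR (not (c (g zero))) * z + natR R rest * z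
    ≈⟨ ≈-sym (distribʳ z _ _) ⟩
      (indR (not (c (g zero))) + natR R rest) * z
    ≈⟨ *-cong (≈-sym (≈-trans (natR-+ (ind (not (c (g zero)))) rest) (+-cong (natR-ind (not (c (g zero)))) ≈-refl)))
              ≈-refl ⟩
      natR R (ind (not (c (g zero))) ℕ.+ rest) * z
    ≈⟨ ≈-reflexive (cong (λ t → natR R t * z) (sym (countB-∷ (not ∘ c) (g zero) (L.tabulate (g ∘ suc))))) ⟩
      natR R (countB (not ∘ c) (L.tabulate g)) * z ∎
    where
    rest = countB (not ∘ c) (L.tabulate (g ∘ suc))
    term : ∀ b → (if b then 0# else z) ≈ indR (not b) * z
    term true = ≈-sym (zeroˡ z)
    term false = ≈-sym (*-identityˡ z)

  offDiag : ∀ b → (if b then indR false else 0#) ≈ 0#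
  offDiag true = ≈-refl
  offDiag false = ≈-refl

  sum-indicator : {N : ℕ} (p : Fin N → Bool) (j : Fin N) →
    sum (λ i → if p i then indR (eqFin i j) else 0#) ≈ indR (p j)
  sum-indicator {suc N} p zero =
    ≈-trans (+-cong (atZero (p zero)) (≈-trans (sum-cong (λ i → offDiag (p (suc i)))) (sum-replicate-zero N)))
      (+-identityʳ _)
    where
    atZero : ∀ b → (if b then indR true else 0#) ≈ indR b
    atZero true = ≈-refl
    atZero false = ≈-refl
  sum-indicator {suc N} p (suc j) =
    ≈-trans (+-cong (offDiag (p zero)) (≈-trans (sum-cong shift) (sum-indicator (p ∘ suc) j))) (+-identityˡ _)
    where
    shift : ∀ i → (if p (suc i) then indR (eqFin (suc i) (suc j)) else 0#) ≈ (if p (suc i) then indR (eqFin i j) else 0#)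
    shift i = ≈-reflexive (cong (λ b → if p (suc i) then indR b else 0#) (eqFin-suc i j))

  filter-indicator : {N : ℕ} (p : Fin N → Bool) (j : Fin N) →
    ΣL (filterB p (L.allFin N)) (λ i → indR (eqFin i j)) ≈ indR (p j)
  filter-indicator {N} p j = ≈-trans (ΣL-filterB p (L.allFin N) _)
    (≈-trans (≈-reflexive (ΣL-allFin (λ i → if p i then indR (eqFin i j) else 0#))) (sum-indicator p j))

module Evaluation (R : CommutativeRing 0ℓ 0ℓ) where
  open CommutativeRing R hiding (zero) renaming (refl to ≈-refl; reflexive to ≈-reflexive; sym to ≈-sym; trans to ≈-trans)
  open RingSums R
  open NatCoeffSolver commutativeSemiring using (solve; _:+_; _:*_; _:=_)
  open import Relation.Binary.Reasoning.Setoid setoid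

  eval-sumE-map : ∀ {V A : Set} (ρ : V → Carrier) (F : A → Expr V) (xs : List A) →
    eval R ρ (sumE (L.map F xs)) ≡ ΣL xs (eval R ρ ∘ F)
  eval-sumE-map ρ F [] = refl
  eval-sumE-map ρ F (a ∷ xs) = cong (eval R ρ (F a) +_) (eval-sumE-map ρ F xs)

  eval-prodE : ∀ {V : Set} {m} (ρ : V → Carrier) (f : Fin m → Expr V) → eval R ρ (prodE f) ≈ prod (eval R ρ ∘ f)
  eval-prodE {m = zero} ρ f = +-identityʳ 1#
  eval-prodE {m = suc m} ρ f = *-cong ≈-refl (eval-prodE ρ (f ∘ suc))

  eval-powE : ∀ {V : Set} (ρ : V → Carrier) (v : V) c → eval R ρ (powE (var v) c) ≈ ρ v ^ c
  eval-powE ρ v zero = +-identityʳ 1#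
  eval-powE ρ v (suc c) = *-cong ≈-refl (eval-powE ρ v c)

  eval-∂var : ∀ {V : Set} (ρ : V → Carrier) (eq : V → V → Bool) (v w : V) →
    eval R ρ (∂[ eq ] v (var w)) ≈ indR (eq v w)
  eval-∂var ρ eq v w with eq v w
  ... | true = +-identityʳ 1#
  ... | false = ≈-refl

  eval-∂powα : ∀ {N} (ρ : Var N → Carrier) (v : Var N) → eqVar v α ≡ false → ∀ c →
    eval R ρ (∂[ eqVar ] v (powE (var α) c)) ≈ 0#
  eval-∂powα ρ v v≢α zero = ≈-refl
  eval-∂powα ρ v v≢α (suc c) rewrite v≢α =
    ≈-trans (+-cong (zeroˡ _) (≈-trans (*-cong ≈-refl (eval-∂powα ρ v v≢α c)) (zeroʳ _))) (+-identityʳ 0#)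

  eval-∂prodE : ∀ {V : Set} {m} (ρ : V → Carrier) (eq : V → V → Bool) (v : V) (f : Fin m → Expr V) →
    eval R ρ (∂[ eq ] v (prodE f)) ≈ sum (λ i → eval R ρ (∂[ eq ] v (f i)) * prodExcept i (eval R ρ ∘ f))
  eval-∂prodE {m = zero} ρ eq v f = ≈-refl
  eval-∂prodE {m = suc m} ρ eq v f = begin
      d zero * eval R ρ (prodE (f ∘ suc)) + e zero * eval R ρ (∂[ eq ] v (prodE (f ∘ suc)))
    ≈⟨ +-cong (*-cong ≈-refl (≈-trans (eval-prodE ρ (f ∘ suc)) (≈-sym (*-identityˡ _))))
              (*-cong ≈-refl (eval-∂prodE ρ eq v (f ∘ suc))) ⟩
      d zero * (1# * prod (e ∘ suc)) + e zero * sum (λ i → d (suc i) * prodExcept i (e ∘ suc))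
    ≈⟨ +-cong ≈-refl (≈-trans (*-distribˡ-sum (e zero) (λ i → d (suc i) * prodExcept i (e ∘ suc))) (sum-cong (λ i → ≈-trans
         (solve 3 (λ p q r → p :* (q :* r) := q :* (p :* r)) ≈-refl (e zero) (d (suc i)) (prodExcept i (e ∘ suc)))
         (*-cong ≈-refl (*-cong ≈-refl (prod-cong (λ l → ≈-sym (shift i l)))))))) ⟩
      sum (λ i → d i * prodExcept i e) ∎
    where
    d e : Fin (suc m) → Carrier
    d i = eval R ρ (∂[ eq ] v (f i))
    e i = eval R ρ (f i)
    shift : ∀ i l → (if eqFin (suc l) (suc i) then 1# else e (suc l)) ≈ (if eqFin l i then 1# else e (suc l))
    shift i l = ≈-reflexive (cong (λ b → if b then 1# else e (suc l)) (eqFin-suc l i))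

  eval-permSum : ∀ {m N} (ρ : Var N → Carrier) (W : (Fin m → Fin m) → Fin m → Var N) →
    eval R ρ (permSum W) ≈ ΣL (perms m) (λ τ → ρ α ^ cyc τ * prod (ρ ∘ W τ))
  eval-permSum {m} ρ W = ≈-trans (≈-reflexive (eval-sumE-map ρ _ (perms m)))
    (ΣL-cong (perms m) (λ τ → *-cong (eval-powE ρ α (cyc τ)) (eval-prodE ρ (var ∘ W τ))))

  eval-∂-permSum : ∀ {m N} (ρ : Var N → Carrier) (W : (Fin m → Fin m) → Fin m → Var N) (v : Var N) →
    eqVar v α ≡ false →
    eval R ρ (∂[ eqVar ] v (permSum W)) ≈
    ΣL (perms m) (λ τ → ρ α ^ cyc τ * sum (λ l → indR (eqVar v (W τ l)) * prodExcept l (ρ ∘ W τ)))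
  eval-∂-permSum {m} {N} ρ W v v≢α = begin
      eval R ρ (∂[ eqVar ] v (permSum W))
    ≡⟨ cong (eval R ρ) (∂-sumE-map eqVar v _ (perms m)) ⟩
      eval R ρ (sumE (L.map (λ τ → ∂[ eqVar ] v (term τ)) (perms m)))
    ≡⟨ eval-sumE-map ρ (λ τ → ∂[ eqVar ] v (term τ)) (perms m) ⟩
      ΣL (perms m) (λ τ → eval R ρ (∂[ eqVar ] v (term τ)))
    ≈⟨ ΣL-cong (perms m) ∂term ⟩
      ΣL (perms m) (λ τ → ρ α ^ cyc τ * sum (λ l → indR (eqVar v (W τ l)) * prodExcept l (ρ ∘ W τ))) ∎
    where
    term : (Fin m → Fin m) → Expr (Var N)
    term τ = powE (var α) (cyc τ) ⊗ prodE (λ l → var (W τ l))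
    ∂term : ∀ τ →
      eval R ρ (∂[ eqVar ] v (term τ)) ≈ ρ α ^ cyc τ * sum (λ l → indR (eqVar v (W τ l)) * prodExcept l (ρ ∘ W τ))
    ∂term τ = ≈-trans (+-cong (≈-trans (*-cong (eval-∂powα ρ v v≢α (cyc τ)) ≈-refl) (zeroˡ _))
                              (*-cong (eval-powE ρ α (cyc τ)) (eval-∂prodE ρ eqVar v (var ∘ W τ))))
      (≈-trans (+-identityˡ _) (*-cong ≈-refl (sum-cong (λ l → *-cong (eval-∂var ρ eqVar v (W τ l)) ≈-refl))))

module LastPointExpansion (m : ℕ) (A : Matrix01 (suc m)) (ferrers : IsFerrers A)
    (ann : A (fromℕ m) (fromℕ m) ≡ false)
    (R : CommutativeRing 0ℓ 0ℓ) (ρ : Var (suc m) → CommutativeRing.Carrier R) where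
  open CommutativeRing R hiding (zero) renaming (refl to ≈-refl; reflexive to ≈-reflexive; sym to ≈-sym; trans to ≈-trans)
  open RingSums R
  open Evaluation R
  open NatCoeffSolver commutativeSemiring using (solve; _:+_; _:*_; _:=_)
  open import Relation.Binary.Reasoning.Setoid setoid

  n : Fin (suc m)
  n = fromℕ m

  a X Y : Carrier
  a = ρ α
  X = ρ (x n)
  Y = ρ (y n)

  k k′ : ℕ
  k = zerosLastCol A
  -- the zeros of the last column strictly above row n
  k′ = countB (λ j → not (A j n)) (L.tabulate inject₁)

  c : Fin m → Bool
  c l = A (inject₁ l) n

  β : Fin (suc m) → Fin (suc m) → Carrier
  β i j = ρ (entry A i j)
  b : Fin m → Fin m → Carrier
  b l j = β (inject₁ l) (inject₁ j)

  -- the terms of per(B(A)), of per(B(A°)), and of ∂ per(B(A°))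
  E : (Fin (suc m) → Fin (suc m)) → Carrier
  E σ = a ^ cyc σ * prod (λ i → β i (σ i))
  T : (Fin m → Fin m) → Carrier
  T τ = a ^ cyc τ * prod (λ l → b l (τ l))
  T̂ : (Fin m → Fin m) → Fin m → Carrier
  T̂ τ l = prodExcept l (λ l' → b l' (τ l'))
  D : (Fin m → Fin m) → Carrier
  D τ = a ^ cyc τ * sum (λ l → indR (c l) * T̂ τ l)

  -- Ferrers shape: rows are weakly increasing, so a 1 in a row forces a 1 at
  -- its end; the last row is zero since a_nn = 0; and the last column is
  -- weakly decreasing, hence 1 exactly in its first (m + 1) − k rows.
  row-one : ∀ i j → A i j ≡ true → A i n ≡ true
  row-one i j = ≤-true (proj₂ ferrers i j n (FP.≤fromℕ j))

  row-zero : ∀ i j → A i n ≡ false → A i j ≡ false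
  row-zero i j = ≤-false (proj₂ ferrers i j n (FP.≤fromℕ j))

  lastCol : ∀ j → A j n ≡ ⌊ toℕ j ℕ.<? (suc m ∸ k) ⌋
  lastCol = decreasing-column (suc m) (λ j → A j n) (λ i i' le → ≤-true (proj₁ ferrers i i' n le))

  k≡k′+1 : k ≡ k′ ℕ.+ 1
  k≡k′+1 = trans (countB-tab-last (λ i → not (A i n)) (λ z → z)) (cong (λ t → k′ ℕ.+ ind (not t)) ann)

  β-lastRow : ∀ j → β n j ≡ X
  β-lastRow j rewrite row-zero n j ann = refl

  β-lastCol : ∀ l → β (inject₁ l) n ≡ (if c l then Y else ρ (x (inject₁ l)))
  β-lastCol l with c l
  ... | true = refl
  ... | false = refl

  b-zeroRow : ∀ l j → c l ≡ false → b l j ≡ ρ (x (inject₁ l))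
  b-zeroRow l j cl rewrite row-zero (inject₁ l) (inject₁ j) cl = refl

  E-cong : ∀ {σ σ'} → σ ≗ σ' → E σ ≈ E σ'
  E-cong {σ} {σ'} H = *-cong (≈-reflexive (cong (a ^_) (cyc-cong H))) (prod-cong (λ i → ≈-reflexive (cong (β i) (H i))))

  E-ext : ∀ τ → Inj τ → E (ext τ) ≈ a * X * T τ
  E-ext τ inj = begin
      a ^ cyc (ext τ) * prod (λ i → β i (ext τ i))
    ≈⟨ *-cong (≈-reflexive (cong (a ^_) (cyc-ext τ inj))) (prod-init-last (λ i → β i (ext τ i))) ⟩
      (a * a ^ cyc τ) * (prod (λ l → β (inject₁ l) (ext τ (inject₁ l))) * β n (ext τ n))
    ≈⟨ *-cong ≈-refl (*-cong (prod-cong (λ l → ≈-reflexive (cong (β (inject₁ l)) (ext-below τ l))))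
                             (≈-reflexive (β-lastRow (ext τ n)))) ⟩
      (a * a ^ cyc τ) * (prod (λ l → b l (τ l)) * X)
    ≈⟨ solve 4 (λ p q r s → (p :* q) :* (r :* s) := p :* s :* (q :* r)) ≈-refl a (a ^ cyc τ) (prod (λ l → b l (τ l))) X ⟩
      a * X * T τ ∎

  E-ins : ∀ τ i → Inj τ → E (ins τ i) ≈ a ^ cyc τ * ((β (inject₁ i) n * T̂ τ i) * X)
  E-ins τ i inj = *-cong (≈-reflexive (cong (a ^_) (cyc-ins τ i inj)))
    (≈-trans (prod-init-last (λ j → β j (ins τ i j)))
      (*-cong (≈-trans (prod-cong atBelow) (prod-pick i (β (inject₁ i) n) (λ l → b l (τ l))))
              (≈-reflexive (β-lastRow _))))
    where
    pick : Fin m → Bool → Carrier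
    pick l t = if t then β (inject₁ i) n else b l (τ l)
    atBelow : ∀ l → β (inject₁ l) (ins τ i (inject₁ l)) ≈ (if eqFin l i then β (inject₁ i) n else b l (τ l))
    atBelow l with insBelow τ i l
    ... | hit refl h = ≈-reflexive (trans (cong (β (inject₁ l)) h) (cong (pick l) (sym (eqFin-refl l))))
    ... | miss l≢i h = ≈-reflexive (trans (cong (β (inject₁ l)) h) (cong (pick l) (sym (eqFin-≢ l≢i))))

  E-ins-one : ∀ τ i → Inj τ → c i ≡ true → E (ins τ i) ≈ X * Y * (a ^ cyc τ * T̂ τ i)
  E-ins-one τ i inj ci = ≈-trans (E-ins τ i inj) (≈-trans
    (*-cong ≈-refl (*-cong (*-cong (≈-reflexive (trans (β-lastCol i) (cong (λ t → if t then Y else ρ (x (inject₁ i))) ci)))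
                                   ≈-refl) ≈-refl))
    (solve 4 (λ p q r s → p :* ((q :* r) :* s) := s :* q :* (p :* r)) ≈-refl (a ^ cyc τ) Y (T̂ τ i) X))

  E-ins-zero : ∀ τ i → Inj τ → c i ≡ false → E (ins τ i) ≈ X * T τ
  E-ins-zero τ i inj ci = ≈-trans (E-ins τ i inj) (≈-trans
    (*-cong ≈-refl (*-cong (≈-trans (*-cong (≈-reflexive xi) ≈-refl) (≈-sym (prod-split i (λ l → b l (τ l))))) ≈-refl))
    (solve 3 (λ p q s → p :* (q :* s) := s :* (p :* q)) ≈-refl (a ^ cyc τ) (prod (λ l → b l (τ l))) X))
    where
    xi : β (inject₁ i) n ≡ b i (τ i)
    xi = trans (β-lastCol i) (trans (cong (λ t → if t then Y else ρ (x (inject₁ i))) ci) (sym (b-zeroRow i (τ i) ci)))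

  sum-E-ins : ∀ τ → Inj τ → sum (λ i → E (ins τ i)) ≈ natR R k′ * (X * T τ) + X * Y * D τ
  sum-E-ins τ inj = begin
      sum (λ i → E (ins τ i))
    ≈⟨ sum-cong (λ i → byRowEnd i (c i) refl) ⟩
      sum (λ i → (if c i then 0# else X * T τ) + indR (c i) * Z i)
    ≈⟨ ∑-distrib-+ (λ i → if c i then 0# else X * T τ) (λ i → indR (c i) * Z i) ⟩
      sum (λ i → if c i then 0# else X * T τ) + sum (λ i → indR (c i) * Z i)
    ≈⟨ +-cong (sum-count inject₁ (λ j → A j n) (X * T τ)) (≈-trans (sum-cong regroup)
         (≈-trans (≈-sym (*-distribˡ-sum (X * Y) (λ i → a ^ cyc τ * (indR (c i) * T̂ τ i))))
           (*-cong ≈-refl (≈-sym (*-distribˡ-sum (a ^ cyc τ) (λ i → indR (c i) * T̂ τ i)))))) ⟩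
      natR R k′ * (X * T τ) + X * Y * D τ ∎
    where
    Z : Fin m → Carrier
    Z i = X * Y * (a ^ cyc τ * T̂ τ i)
    byRowEnd : ∀ i bit → c i ≡ bit → E (ins τ i) ≈ (if bit then 0# else X * T τ) + indR bit * Z i
    byRowEnd i true ci = ≈-trans (E-ins-one τ i inj ci) (≈-sym (≈-trans (+-identityˡ _) (*-identityˡ (Z i))))
    byRowEnd i false ci = ≈-trans (E-ins-zero τ i inj ci) (≈-sym (≈-trans (+-cong ≈-refl (zeroˡ (Z i))) (+-identityʳ _)))
    regroup : ∀ i → indR (c i) * Z i ≈ X * Y * (a ^ cyc τ * (indR (c i) * T̂ τ i))
    regroup i = solve 5 (λ s p q r t → s :* (p :* q :* (r :* t)) := p :* q :* (r :* (s :* t)))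
      ≈-refl (indR (c i)) X Y (a ^ cyc τ) (T̂ τ i)

  blockTerm : (Fin m → Fin m) → Carrier
  blockTerm τ = (a + natR R k′) * X * T τ + X * Y * D τ

  block-sum : ∀ w → Inj (V.lookup w) → ΣL (block w) (E ∘ V.lookup) ≈ blockTerm (V.lookup w)
  block-sum w inj = begin
      E (V.lookup (extV w)) + ΣL (L.map (insV w) (L.allFin m)) (E ∘ V.lookup)
    ≈⟨ +-cong (≈-trans (E-cong (VP.lookup∘tabulate (ext τ))) (E-ext τ inj))
              (≈-reflexive (trans (ΣL-map (insV w) (L.allFin m) (E ∘ V.lookup)) (ΣL-allFin (E ∘ V.lookup ∘ insV w)))) ⟩
      a * X * T τ + sum (λ i → E (V.lookup (insV w i)))
    ≈⟨ +-cong ≈-refl (≈-trans (sum-cong (λ i → E-cong (VP.lookup∘tabulate (ins τ i)))) (sum-E-ins τ inj)) ⟩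
      a * X * T τ + (natR R k′ * (X * T τ) + X * Y * D τ)
    ≈⟨ solve 6 (λ p q t kk yy d → p :* q :* t :+ (kk :* (q :* t) :+ q :* yy :* d) := (p :+ kk) :* q :* t :+ q :* yy :* d)
         ≈-refl a X (T τ) (natR R k′) Y (D τ) ⟩
      blockTerm τ ∎
    where
    τ = V.lookup w

  expand-per : eval R ρ (per (BM A)) ≈ (a + natR R k′) * X * ΣL (perms m) T + X * Y * ΣL (perms m) D
  expand-per = begin
      eval R ρ (per (BM A))
    ≡⟨ cong (eval R ρ) (per-BM A) ⟩
      eval R ρ (permSum (λ σ i → entry A i (σ i)))
    ≈⟨ eval-permSum ρ (λ σ i → entry A i (σ i)) ⟩
      ΣL (perms (suc m)) E
    ≡⟨ ΣL-map V.lookup (permVecs (suc m)) E ⟩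
      ΣL (permVecs (suc m)) (E ∘ V.lookup)
    ≈⟨ ΣL-↭ (E ∘ V.lookup) (perms-step m) ⟩
      ΣL (grown m) (E ∘ V.lookup)
    ≈⟨ ΣL-concatMap block (permVecs m) (E ∘ V.lookup) ⟩
      ΣL (permVecs m) (λ w → ΣL (block w) (E ∘ V.lookup))
    ≈⟨ ΣL-cong∈ (permVecs m) (λ w w∈ → block-sum w (permVecs-∈⁻ w∈)) ⟩
      ΣL (permVecs m) (blockTerm ∘ V.lookup)
    ≡⟨ ΣL-map V.lookup (permVecs m) blockTerm ⟨
      ΣL (perms m) blockTerm
    ≈⟨ ΣL-+ (perms m) (λ τ → (a + natR R k′) * X * T τ) (λ τ → X * Y * D τ) ⟩
      ΣL (perms m) (λ τ → (a + natR R k′) * X * T τ) + ΣL (perms m) (λ τ → X * Y * D τ)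
    ≈⟨ +-cong (ΣL-*ˡ (perms m) ((a + natR R k′) * X) T) (ΣL-*ˡ (perms m) (X * Y) D) ⟩
      (a + natR R k′) * X * ΣL (perms m) T + X * Y * ΣL (perms m) D ∎

  W : (Fin m → Fin m) → Fin m → Var (suc m)
  W τ l = entry A (inject₁ l) (inject₁ (τ l))

  eval-per° : eval R ρ (rename liftVar (per (BM (circ A)))) ≈ ΣL (perms m) T
  eval-per° = ≈-trans (≈-reflexive (cong (eval R ρ) (rename-per-BM A))) (eval-permSum ρ W)

  ∂-along : {J : Set} (e : J → Var (suc m)) → (∀ j → eqVar (e j) α ≡ false) → (js : List J) →
    eval R ρ (sumE (L.map (λ j → ∂[ eqVar ] (e j) (permSum W)) js)) ≈
    ΣL (perms m) (λ τ → a ^ cyc τ * sum (λ l → ΣL js (λ j → indR (eqVar (e j) (W τ l))) * T̂ τ l))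
  ∂-along {J} e e≢α js = begin
      eval R ρ (sumE (L.map (λ j → ∂[ eqVar ] (e j) (permSum W)) js))
    ≡⟨ eval-sumE-map ρ (λ j → ∂[ eqVar ] (e j) (permSum W)) js ⟩
      ΣL js (λ j → eval R ρ (∂[ eqVar ] (e j) (permSum W)))
    ≈⟨ ΣL-cong js (λ j → eval-∂-permSum ρ W (e j) (e≢α j)) ⟩
      ΣL js (λ j → ΣL (perms m) (λ τ → a ^ cyc τ * sum (λ l → h j τ l * T̂ τ l)))
    ≈⟨ ΣL-swap js (perms m) (λ j τ → a ^ cyc τ * sum (λ l → h j τ l * T̂ τ l)) ⟩
      ΣL (perms m) (λ τ → ΣL js (λ j → a ^ cyc τ * sum (λ l → h j τ l * T̂ τ l)))
    ≈⟨ ΣL-cong (perms m) (λ τ → ≈-trans (ΣL-*ˡ js (a ^ cyc τ) _) (*-cong ≈-refl (inner τ))) ⟩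
      ΣL (perms m) (λ τ → a ^ cyc τ * sum (λ l → ΣL js (λ j → h j τ l) * T̂ τ l)) ∎
    where
    h : J → (Fin m → Fin m) → Fin m → Carrier
    h j τ l = indR (eqVar (e j) (W τ l))
    inner : ∀ τ → ΣL js (λ j → sum (λ l → h j τ l * T̂ τ l)) ≈ sum (λ l → ΣL js (λ j → h j τ l) * T̂ τ l)
    inner τ = ≈-trans (ΣL-cong js (λ j → ≈-reflexive (sym (ΣL-allFin (λ l → h j τ l * T̂ τ l)))))
      (≈-trans (ΣL-swap js (L.allFin m) (λ j l → h j τ l * T̂ τ l))
      (≈-trans (≈-reflexive (ΣL-allFin (λ l → ΣL js (λ j → h j τ l * T̂ τ l))))
      (sum-cong (λ l → ΣL-*ʳ js (λ j → h j τ l) (T̂ τ l)))))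

  px py : Fin (suc m) → Bool
  px i = ⌊ toℕ i ℕ.<? (suc m ∸ k) ⌋
  py j = ⌊ toℕ j ℕ.<? m ⌋
  Lx Ly : List (Fin (suc m))
  Lx = filterB px (L.allFin (suc m))
  Ly = filterB py (L.allFin (suc m))

  -- The factor b_{l,τ l} is hit by exactly one derivation in ∂ when row l ends
  -- with 1 (it is y_{τ l}, or x_l with l < (m + 1) − k), and by none otherwise.
  coefficient : ∀ τ l →
    ΣL Lx (λ i → indR (eqVar (x i) (W τ l))) + ΣL Ly (λ j → indR (eqVar (y j) (W τ l))) ≈ indR (c l)
  coefficient τ l with A (inject₁ l) (inject₁ (τ l)) in alτl
  ... | true = ≈-trans (+-cong (ΣL-0 Lx) (filter-indicator py (inject₁ (τ l))))
      (≈-trans (+-identityˡ _) (≈-reflexive (cong indR (trans below-m (sym (row-one (inject₁ l) (inject₁ (τ l)) alτl))))))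
    where
    below-m : ⌊ toℕ (inject₁ (τ l)) ℕ.<? m ⌋ ≡ true
    below-m = ⇒does (toℕ (inject₁ (τ l)) ℕ.<? m) (FP.inject₁ℕ< (τ l))
  ... | false = ≈-trans (+-cong (filter-indicator px (inject₁ l)) (ΣL-0 Ly))
      (≈-trans (+-identityʳ _) (≈-reflexive (cong indR (sym (lastCol (inject₁ l))))))

  eval-∂per° : eval R ρ (∂op m k (rename liftVar (per (BM (circ A))))) ≈ ΣL (perms m) D
  eval-∂per° = begin
      eval R ρ (∂op m k (rename liftVar (per (BM (circ A)))))
    ≡⟨ cong (eval R ρ ∘ ∂op m k) (rename-per-BM A) ⟩
      eval R ρ (∂op m k (permSum W))
    ≈⟨ +-cong (∂-along x (λ _ → refl) Lx) (∂-along y (λ _ → refl) Ly) ⟩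
      ΣL (perms m) (λ τ → a ^ cyc τ * sum (λ l → Cx τ l * T̂ τ l))
        + ΣL (perms m) (λ τ → a ^ cyc τ * sum (λ l → Cy τ l * T̂ τ l))
    ≈⟨ ≈-sym (ΣL-+ (perms m) _ _) ⟩
      ΣL (perms m) (λ τ → a ^ cyc τ * sum (λ l → Cx τ l * T̂ τ l) + a ^ cyc τ * sum (λ l → Cy τ l * T̂ τ l))
    ≈⟨ ΣL-cong (perms m) (λ τ → ≈-trans (≈-sym (distribˡ _ _ _)) (*-cong ≈-refl
         (≈-trans (≈-sym (∑-distrib-+ (λ l → Cx τ l * T̂ τ l) (λ l → Cy τ l * T̂ τ l)))
           (sum-cong (λ l → ≈-trans (≈-sym (distribʳ _ _ _)) (*-cong (coefficient τ l) ≈-refl)))))) ⟩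
      ΣL (perms m) D ∎
    where
    Cx Cy : (Fin m → Fin m) → Fin m → Carrier
    Cx τ l = ΣL Lx (λ i → indR (eqVar (x i) (W τ l)))
    Cy τ l = ΣL Ly (λ j → indR (eqVar (y j) (W τ l)))

  constant : (a + natR R k) + - natR R 1 ≈ a + natR R k′
  constant = begin
      (a + natR R k) + - u
    ≈⟨ +-cong (+-cong ≈-refl (≈-trans (≈-reflexive (cong (natR R) k≡k′+1)) (natR-+ k′ 1))) ≈-refl ⟩
      (a + (natR R k′ + u)) + - u
    ≈⟨ +-cong (≈-sym (+-assoc a (natR R k′) u)) ≈-refl ⟩
      ((a + natR R k′) + u) + - u
    ≈⟨ +-assoc _ u (- u) ⟩
      (a + natR R k′) + (u + - u)
    ≈⟨ +-cong ≈-refl (-‿inverseʳ u) ⟩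
      (a + natR R k′) + 0#
    ≈⟨ +-identityʳ _ ⟩
      a + natR R k′ ∎
    where
    u = natR R 1

-- The integer constants of the statement; imported here, after the ring
-- developments, where the prefix +_ would clash with sections of the ring _+_.
open import Data.Integer using (+_; -[1+_])

lemma4p3 : (m : ℕ) (A : Matrix01 (suc m)) → IsFerrers A →
    A (fromℕ m) (fromℕ m) ≡ false →
    per (BM A) ≈P
      (var α ⊕ con (+ zerosLastCol A) ⊕ con -[1+ 0 ]) ⊗ var (x (fromℕ m))
        ⊗ rename liftVar (per (BM (circ A)))
      ⊕ var (x (fromℕ m)) ⊗ var (y (fromℕ m))
        ⊗ ∂op m (zerosLastCol A) (rename liftVar (per (BM (circ A))))
-- Evaluate both sides in an arbitrary ring: expand per(B(A)) by blocks, then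
-- recognise α + k − 1 = α + k′, per(B(A°)) and ∂ per(B(A°)).
lemma4p3 m A ferrers ann R ρ = begin
    eval R ρ (per (BM A))
  ≈⟨ expand-per ⟩
    (a + natR R k′) * X * ΣL (perms m) T + X * Y * ΣL (perms m) D
  ≈⟨ +-cong (*-cong (*-cong (≈-sym constant) ≈-refl) (≈-sym eval-per°)) (*-cong ≈-refl (≈-sym eval-∂per°)) ⟩
    ((a + natR R k) + - natR R 1) * X * eval R ρ per° + X * Y * eval R ρ (∂op m k per°) ∎
  where
  open CommutativeRing R using (_+_; _*_; -_; +-cong; *-cong) renaming (refl to ≈-refl; sym to ≈-sym)
  open LastPointExpansion m A ferrers ann R ρ
  open RingSums R using (ΣL)
  open import Relation.Binary.Reasoning.Setoid (CommutativeRing.setoid R)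
  per° = rename liftVar (per (BM (circ A)))
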